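{- Let $\omega$ be a permutation and $\alpha=\alpha_1\alpha_2\cdots\alpha_l$ a reduced word of $\omega$. Let $T_\alpha$ be the standard tower tableau of $\alpha$ and $D_\alpha$ the canonical labelling of the Rothe diagram $D_\omega$ associated to $\alpha$. Then the Rothification of $T_\alpha$ equals $D_\alpha$, i.e. $R_{T_\alpha}=D_\alpha$ (same cells and same labels).
   Context: Permutations are written in one-line notation $\omega=\omega_1\cdots\omega_n$; $s_a=(a,a+1)$ and $\omega s_a$ swaps the entries in positions $a,a+1$; a reduced word of $\omega$ is a word $\alpha_1\cdots\alpha_l$ with $\omega=s_{\alpha_1}\cdots s_{\alpha_l}$, $l$ the number of inversions of $\omega$. A tower diagram is a finite sequence $(\mathcal T_1,\mathcal T_2,\ldots)$ of towers; the $i$-th tower of size $k_i\ge0$ consists of the cells $(i,0),\ldots,(i,k_i-1)$, the cell $(i,j)$ being the unit square $[i-1,i]\times[j,j+1]$ identified with its south-east corner, lying on the diagonal $x+y=i+j$; $i$ is its tower index. Sliding. For a positive integer $a$ and a tail $(\mathcal T_p,\ldots)$ of a tower diagram, $a^{\searrow}(\mathcal T_p,\ldots)$ either adds one cell or terminates: (S1) if no tower $\mathcal T_t$, $t\ge p$, has a cell on $x+y=a-1$: (a) if none has a cell on $x+y=a$, add $(a,0)$; (b) if $(a,0)\in\mathcal T_a$, $(a,1)\notin\mathcal T_a$, terminate; (c) if $(a,0),(a,1)\in\mathcal T_a$, result is $(a+1)^{\searrow}(\mathcal T_{a+1},\ldots)$. (S2) Otherwise, with $\mathcal T_i$ ($i\ge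 p$) the leftmost tower having a cell $(i,a-1-i)$: (a) if $(i,a-i)\notin\mathcal T_i$, add it; (b) if $(i,a-i)\in\mathcal T_i$, $(i,a-i+1)\notin\mathcal T_i$, terminate; (c) if both are in $\mathcal T_i$, result is $(a+1)^{\searrow}(\mathcal T_{i+1},\ldots)$. Sliding $a$ into $\mathcal T$ is $a^{\searrow}(\mathcal T_1,\ldots)$. The standard tower tableau $T_\alpha$ of a reduced word $\alpha$ is obtained by sliding its letters one by one into the empty diagram and labelling the cell created by the $k$-th letter with $k$. Rothe diagram: $D_\omega=\{(i,\omega_j): i<j,\ \omega_i>\omega_j\}$, $(r,c)$ meaning row $r$ (rows numbered top to bottom), column $c$. Rothification: for a standard tower tableau $T$ with reading word $\alpha_1\cdots\alpha_l$, let $T'$ be the standard tower tableau of the reversed word $\alpha_l\cdots\alpha_1$; for $1\le r\le l$ let $u_r$ be the cell of $T$ labelled $r$ and $v_r$ the cell of $T'$ labelled $l+1-r$. $R_T$ puts label $r$ on the cell in row (tower index of $v_r$) and column (tower index of $u_r$). Canonical labelling: for a reduced word $\alpha=\alpha_1\cdots\alpha_l$ of $\omega$, form $w^{(0)}=\mathrm{id}$, $w^{(r)}=w^{(r-1)}s_{\alpha_r}$ (so $w^{(l)}=\omega$); step $r$ swaps two values $b>c$. $D_\alpha$ labels the cell $(i,j)\in D_\omega$ (where $j<\omega_i$) by the unique $r$ such that step $r$ swaps the values $\omega_i$ and $j$. -}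

module Defs where

open import Data.Nat using (ℕ; zero; suc; _+_; _∸_; _≤_; _<_; _<ᵇ_; _≤ᵇ_; pred)
open import Data.Bool using (Bool; true; false; if_then_else_)
open import Data.Maybe using (Maybe; just; nothing)
open import Data.Product using (_×_; _,_; proj₁; proj₂; Σ; ∃)
open import Data.Sum using (_⊎_)
open import Data.List using (List; []; _∷_; applyUpTo; filterᵇ; head; foldl; reverse; length; map; zipWith; cartesianProduct; take; _++_)
open import Data.List.Relation.Unary.All using (All)
open import Relation.Binary.PropositionalEquality using (_≡_)

-- at xs k = k-th entry of xs (1-indexed); 0 if out of range
at : List ℕ → ℕ → ℕ
at []       _             = 0
at (x ∷ xs) zero          = 0
at (x ∷ xs) (suc zero)    = x
at (x ∷ xs) (suc (suc k)) = at xs (suc k)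

nth : {A : Set} → List A → ℕ → Maybe A
nth []       _             = nothing
nth (x ∷ xs) zero          = nothing
nth (x ∷ xs) (suc zero)    = just x
nth (x ∷ xs) (suc (suc k)) = nth xs (suc k)

idPerm : ℕ → List ℕ
idPerm n = applyUpTo suc n

-- w ↦ w s_a : swap the entries in positions a, a+1
swapAt : ℕ → List ℕ → List ℕ
swapAt (suc zero)    (x ∷ y ∷ xs) = y ∷ x ∷ xs
swapAt (suc (suc a)) (x ∷ xs)     = x ∷ swapAt (suc a) xs
swapAt _             xs           = xs

-- product  id · s_{α₁} ⋯ s_{αₖ}  in one-line notation (permutations of {1..n})
wordPerm : ℕ → List ℕ → List ℕ
wordPerm n α = foldl (λ w a → swapAt a w) (idPerm n) α

pairsLt : ℕ → List (ℕ × ℕ)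
pairsLt n = filterᵇ (λ p → proj₁ p <ᵇ proj₂ p) (cartesianProduct (idPerm n) (idPerm n))

invPairs : ℕ → List ℕ → List (ℕ × ℕ)
invPairs n ω = filterᵇ (λ p → at ω (proj₂ p) <ᵇ at ω (proj₁ p)) (pairsLt n)

inv : ℕ → List ℕ → ℕ
inv n ω = length (invPairs n ω)

IsReducedWord : ℕ → List ℕ → List ℕ → Set
IsReducedWord n ω α =
  All (λ a → 1 ≤ a × a < n) α × (wordPerm n α ≡ ω) × (length α ≡ inv n ω)

Cell : Set
Cell = ℕ × ℕ

-- D_ω = {(i, ω_j) : i < j, ω_i > ω_j}  as (row , column)
rothe : ℕ → List ℕ → List Cell
rothe n ω = map (λ p → (proj₁ p , at ω (proj₂ p))) (invPairs n ω)

-- the two values swapped at step r (1 ≤ r ≤ l) of  w⁽ʳ⁾ = w⁽ʳ⁻¹⁾ s_{α_r}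
swappedValues : ℕ → List ℕ → ℕ → ℕ × ℕ
swappedValues n α r =
  let w = wordPerm n (take (pred r) α)
      a = at α r
  in (at w a , at w (suc a))

StepSwaps : ℕ → List ℕ → ℕ → ℕ → ℕ → Set
StepSwaps n α r x y =
  (proj₁ (swappedValues n α r) ≡ x × proj₂ (swappedValues n α r) ≡ y) ⊎
  (proj₁ (swappedValues n α r) ≡ y × proj₂ (swappedValues n α r) ≡ x)

CanonLabel : ℕ → List ℕ → List ℕ → Cell → ℕ → Set
CanonLabel n ω α (i , j) r =
  ((i , j) ∈ rothe n ω) × 1 ≤ r × r ≤ length α × StepSwaps n α r (at ω i) j
  where open import Data.List.Membership.Propositional using (_∈_)

-- Tower diagrams: list of tower sizes k₁ k₂ …  (towers beyond the end are empty)
-- Cell (i , j) (i ≥ 1) belongs to the diagram iff j < k_i.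

TowerDiagram : Set
TowerDiagram = List ℕ

size : TowerDiagram → ℕ → ℕ
size = at

incr : TowerDiagram → ℕ → TowerDiagram
incr []       zero          = []
incr (k ∷ ks) zero          = k ∷ ks
incr []       (suc zero)    = 1 ∷ []
incr (k ∷ ks) (suc zero)    = suc k ∷ ks
incr []       (suc (suc i)) = 0 ∷ incr [] (suc i)
incr (k ∷ ks) (suc (suc i)) = k ∷ incr ks (suc i)

-- leftmost tower index t with p ≤ t having a cell (t , d - t) on diagonal x+y = d
leftmostOn : TowerDiagram → ℕ → ℕ → Maybe ℕ
leftmostOn D p d =
  head (filterᵇ (λ t → (d ∸ t) <ᵇ size D t) (applyUpTo (p +_) (suc d ∸ p)))

-- a↘(T_p, …) on diagram D (tail from index p), with fuel.
-- Returns  just c  if cell c is added, nothing if the sliding terminates.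
slideF : ℕ → TowerDiagram → ℕ → ℕ → Maybe Cell
slideF zero       D p a = nothing
slideF (suc fuel) D p a with leftmostOn D p (pred a)
... | nothing with leftmostOn D p a
...   | nothing = just (a , 0)                                -- (S1a)
...   | just _  = if 2 ≤ᵇ size D a
                  then slideF fuel D (suc a) (suc a)          -- (S1c)
                  else nothing                                -- (S1b)
slideF (suc fuel) D p a | just i =
  if size D i ≤ᵇ (a ∸ i) then just (i , a ∸ i)                -- (S2a)
  else if size D i ≤ᵇ suc (a ∸ i) then nothing                -- (S2b)
  else slideF fuel D (suc i) (suc a)                          -- (S2c)

-- sliding a into D: a↘(T₁, …); fuel length D + 1 suffices since the tail
-- index strictly increases and stays ≤ length D + 1.
slide : TowerDiagram → ℕ → Maybe Cell
slide D a = slideF (suc (length D)) D 1 a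

-- slide the letters one by one; the k-th cell of the output is labelled k.
-- nothing if some sliding terminates.
buildTableau : TowerDiagram → List Cell → List ℕ → Maybe (List Cell)
buildTableau D acc []      = just acc
buildTableau D acc (a ∷ α) with slide D a
... | nothing = nothing
... | just c  = buildTableau (incr D (proj₁ c)) (acc ++ (c ∷ [])) α

-- standard tower tableau T_α, as the list of cells in label order
towerTableau : List ℕ → Maybe (List Cell)
towerTableau α = buildTableau [] [] α

-- Rothification R_T of a standard tower tableau T whose reading word is β
-- (T′ = standard tower tableau of the reversed reading word).
-- Result: list of (cell (row , column) , label).
rothification : List ℕ → List Cell → Maybe (List (Cell × ℕ))
rothification β T with towerTableau (reverse β)
... | nothing = nothing
... | just T′ =
  just (zipWith (λ uv r → ((proj₁ (proj₂ uv) , proj₁ (proj₁ uv)) , r))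
                (zipWith _,_ T (reverse T′))
                (applyUpTo suc (length T)))

module Submission where

-- For a word π write w_π = s_{π₁}⋯s_{πₖ}; as a function w_π = perm π and w_π⁻¹ = perm (reverse π).
-- Since α is reduced, each letter a of α is an ascent of the prefix π read before it:
-- c = w_π(a) < b = w_π(a+1); the same holds for the reversed word.
-- The invariant of the sliding is that after π the tower over t has as many cells as there
-- are values v > t placed before t in w_π (the code of w_π⁻¹). Sliding a then climbs the
-- diagonal a + #{v < t placed after position a + 1}: towers placed before position a lie
-- below it, towers placed after position a + 1 rise at least two cells above it (the slide
-- passes them and the count grows by one), and tower c ends exactly on it. So the new cell
-- lies in tower c, and the invariant survives because the new inversion (b, c) only raises
-- the code at c. Thus the k-th cell of T_α lies in tower c and the k-th cell of T′, read
-- backwards, in tower w_α⁻¹(b), the row of b in ω; the Rothification therefore labels the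
-- cell (w_α⁻¹(b), c) by k, which is the cell of D_ω whose values are swapped at step k.

open import Defs
open import Data.Nat using (ℕ)
open import Data.List using (List)
open import Data.Maybe using (just)
open import Data.Product using (_×_; _,_; ∃)
open import Data.List.Membership.Propositional using (_∈_)
open import Function.Bundles using (_⇔_)
open import Relation.Binary.PropositionalEquality using (_≡_)

open import Data.Nat
open import Data.Nat.Properties
open import Data.Nat.ListAction using (sum)
open import Data.Nat.ListAction.Properties using (sum-++)
open import Data.Nat.Tactic.RingSolver using (solve-∀)
open import Data.Bool using (Bool; true; false; if_then_else_)
open import Data.Bool.Properties using (T?)
open import Data.Empty using (⊥-elim)
open import Data.Unit using (⊤; tt)
open import Data.Maybe using (nothing)
open import Data.Product using (proj₁; proj₂)
open import Data.Sum using (_⊎_; inj₁; inj₂; [_,_]′)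
open import Data.List using ([]; _∷_; _++_; [_]; length; foldl; applyUpTo; filterᵇ; head; map; take; drop; reverse; zipWith; cartesianProduct)
open import Data.List.Properties using (unfold-reverse; reverse-involutive; reverse-++; reverse-map; ++-assoc; ++-identityʳ; foldl-++; length-applyUpTo; length-map; applyUpTo-∷ʳ; ∷-injective; map-++; map-∘; map-cong)
open import Data.List.Relation.Unary.All using (All; []; _∷_)
open import Data.List.Relation.Unary.All.Properties using () renaming (++⁺ to All-++⁺; ++⁻ˡ to All-++⁻ˡ; ++⁻ʳ to All-++⁻ʳ)
open import Data.List.Relation.Binary.Permutation.Propositional using (↭-sym)
open import Data.List.Relation.Binary.Permutation.Propositional.Properties using (All-resp-↭; ↭-reverse)
open import Data.List.Membership.Propositional.Properties using (∈-map⁺; ∈-map⁻; ∈-filter⁺; ∈-filter⁻; ∈-applyUpTo⁺; ∈-applyUpTo⁻; ∈-cartesianProduct⁺; ∈-cartesianProduct⁻)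
open import Function.Base using (_∘_)
open import Function.Bundles using (mk⇔)
open import Relation.Nullary using (¬_; yes; no)
open import Relation.Binary using (tri<; tri≈; tri>)
open import Relation.Binary.PropositionalEquality using (refl; sym; trans; cong; cong₂; subst; subst₂; _≢_; ≢-sym; module ≡-Reasoning)

<ᵇ-true : ∀ {m n} → m < n → (m <ᵇ n) ≡ true
<ᵇ-true {zero}  {suc n} _       = refl
<ᵇ-true {suc m} {suc n} (s≤s p) = <ᵇ-true p

<ᵇ-false : ∀ {m n} → n ≤ m → (m <ᵇ n) ≡ false
<ᵇ-false {m}     {zero}  _       = refl
<ᵇ-false {suc m} {suc n} (s≤s p) = <ᵇ-false p

≤ᵇ-true : ∀ {m n} → m ≤ n → (m ≤ᵇ n) ≡ true
≤ᵇ-true {zero}  _         = refl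
≤ᵇ-true {suc m} (s≤s p)   = <ᵇ-true (s≤s p)

≤ᵇ-false : ∀ {m n} → n < m → (m ≤ᵇ n) ≡ false
≤ᵇ-false {suc m} (s≤s p) = <ᵇ-false p

≡ᵇ-refl : ∀ m → (m ≡ᵇ m) ≡ true
≡ᵇ-refl zero    = refl
≡ᵇ-refl (suc m) = ≡ᵇ-refl m

≡ᵇ-false : ∀ {m n} → m ≢ n → (m ≡ᵇ n) ≡ false
≡ᵇ-false {zero}  {zero}  p = ⊥-elim (p refl)
≡ᵇ-false {zero}  {suc n} p = refl
≡ᵇ-false {suc m} {zero}  p = refl
≡ᵇ-false {suc m} {suc n} p = ≡ᵇ-false (λ q → p (cong suc q))

-- Iverson brackets

χ< : ℕ → ℕ → ℕ
χ< _       zero    = 0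
χ< zero    (suc _) = 1
χ< (suc x) (suc y) = χ< x y

χ≡ : ℕ → ℕ → ℕ
χ≡ zero    zero    = 1
χ≡ zero    (suc _) = 0
χ≡ (suc _) zero    = 0
χ≡ (suc x) (suc y) = χ≡ x y

χ<-1 : ∀ {x y} → x < y → χ< x y ≡ 1
χ<-1 {zero}  {suc y} _       = refl
χ<-1 {suc x} {suc y} (s≤s p) = χ<-1 p

χ<-0 : ∀ {x y} → y ≤ x → χ< x y ≡ 0
χ<-0 {x}     {zero}  _       = refl
χ<-0 {suc x} {suc y} (s≤s p) = χ<-0 p

χ<-≤1 : ∀ x y → χ< x y ≤ 1
χ<-≤1 x       zero    = z≤n
χ<-≤1 zero    (suc y) = ≤-refl
χ<-≤1 (suc x) (suc y) = χ<-≤1 x y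

χ<≡1⇒< : ∀ x y → χ< x y ≡ 1 → x < y
χ<≡1⇒< x       zero    ()
χ<≡1⇒< zero    (suc y) _ = s≤s z≤n
χ<≡1⇒< (suc x) (suc y) p = s≤s (χ<≡1⇒< x y p)

χ≡-refl : ∀ x → χ≡ x x ≡ 1
χ≡-refl zero    = refl
χ≡-refl (suc x) = χ≡-refl x

χ≡-0 : ∀ {x y} → x ≢ y → χ≡ x y ≡ 0
χ≡-0 {zero}  {zero}  p = ⊥-elim (p refl)
χ≡-0 {zero}  {suc y} p = refl
χ≡-0 {suc x} {zero}  p = refl
χ≡-0 {suc x} {suc y} p = χ≡-0 (λ q → p (cong suc q))

χ<*-≤ : ∀ x y z → χ< x y * z ≤ z
χ<*-≤ x       zero    z = z≤n
χ<*-≤ zero    (suc y) z = ≤-reflexive (+-identityʳ z)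
χ<*-≤ (suc x) (suc y) z = χ<*-≤ x y z

*χ<-≤ : ∀ x y z → z * χ< x y ≤ z
*χ<-≤ x y z = subst (_≤ z) (*-comm (χ< x y) z) (χ<*-≤ x y z)

data Compareχ (x y : ℕ) : Set where
  χ-less    : x < y → χ< x y ≡ 1 → χ< y x ≡ 0 → χ≡ x y ≡ 0 → Compareχ x y
  χ-equal   : x ≡ y → χ< x y ≡ 0 → χ< y x ≡ 0 → χ≡ x y ≡ 1 → Compareχ x y
  χ-greater : y < x → χ< x y ≡ 0 → χ< y x ≡ 1 → χ≡ x y ≡ 0 → Compareχ x y

compareχ : ∀ x y → Compareχ x y
compareχ x y with <-cmp x y
... | tri< p _ _    = χ-less p (χ<-1 p) (χ<-0 (<⇒≤ p)) (χ≡-0 (<⇒≢ p))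
... | tri≈ _ refl _ = χ-equal refl (χ<-0 {x} ≤-refl) (χ<-0 {x} ≤-refl) (χ≡-refl x)
... | tri> _ _ p    = χ-greater p (χ<-0 (<⇒≤ p)) (χ<-1 p) (χ≡-0 (≢-sym (<⇒≢ p)))

-- Finite sums f 1 + ⋯ + f n

∑ : (ℕ → ℕ) → ℕ → ℕ
∑ f zero    = 0
∑ f (suc n) = ∑ f n + f (suc n)

∑-cong : ∀ (f g : ℕ → ℕ) n → (∀ v → 1 ≤ v → v ≤ n → f v ≡ g v) → ∑ f n ≡ ∑ g n
∑-cong f g zero    h = refl
∑-cong f g (suc n) h =
  cong₂ _+_ (∑-cong f g n (λ v p q → h v p (m≤n⇒m≤1+n q))) (h (suc n) (s≤s z≤n) ≤-refl)

∑-distrib-+ : ∀ (f g : ℕ → ℕ) n → ∑ (λ v → f v + g v) n ≡ ∑ f n + ∑ g n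
∑-distrib-+ f g zero    = refl
∑-distrib-+ f g (suc n) rewrite ∑-distrib-+ f g n = +-exchange (∑ f n) (∑ g n) (f (suc n)) (g (suc n))
  where
  +-exchange : ∀ a b c d → a + b + (c + d) ≡ a + c + (b + d)
  +-exchange = solve-∀

∑-mono-≤ : ∀ (f g : ℕ → ℕ) n → (∀ v → 1 ≤ v → v ≤ n → f v ≤ g v) → ∑ f n ≤ ∑ g n
∑-mono-≤ f g zero    h = z≤n
∑-mono-≤ f g (suc n) h =
  +-mono-≤ (∑-mono-≤ f g n (λ v p q → h v p (m≤n⇒m≤1+n q))) (h (suc n) (s≤s z≤n) ≤-refl)

∑-zero : ∀ (f : ℕ → ℕ) n → (∀ v → 1 ≤ v → v ≤ n → f v ≡ 0) → ∑ f n ≡ 0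
∑-zero f zero    h = refl
∑-zero f (suc n) h = cong₂ _+_ (∑-zero f n (λ v p q → h v p (m≤n⇒m≤1+n q))) (h (suc n) (s≤s z≤n) ≤-refl)

∑-delta : ∀ (f : ℕ → ℕ) n j → 1 ≤ j → j ≤ n →
  (∀ v → 1 ≤ v → v ≤ n → v ≢ j → f v ≡ 0) → ∑ f n ≡ f j
∑-delta f zero    j p q h = ⊥-elim (<⇒≱ p q)
∑-delta f (suc n) j p q h with j ≟ suc n
... | yes refl = cong (_+ f j) (∑-zero f n (λ v a b → h v a (m≤n⇒m≤1+n b) (<⇒≢ (s≤s b))))
... | no j≢   = trans (cong₂ _+_ (∑-delta f n j p (≤-pred (≤∧≢⇒< q j≢)) (λ v a b → h v a (m≤n⇒m≤1+n b)))
                                 (h (suc n) (s≤s z≤n) ≤-refl (≢-sym j≢)))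
                      (+-identityʳ (f j))

∑-χ<-below : ∀ n k → n < k → ∑ (λ v → χ< v k) n ≡ n
∑-χ<-below zero    k _ = refl
∑-χ<-below (suc n) k p =
  trans (cong₂ _+_ (∑-χ<-below n k (<-trans (n<1+n n) p)) (χ<-1 p)) (+-comm n 1)

∑-χ< : ∀ n k → k ≤ suc n → ∑ (λ v → χ< v k) n ≡ pred k
∑-χ< zero    zero          _ = refl
∑-χ< zero    (suc zero)    _ = refl
∑-χ< zero    (suc (suc k)) (s≤s ())
∑-χ< (suc n) k p with m≤n⇒m<n∨m≡n p
... | inj₁ k≤n  = trans (cong₂ _+_ (∑-χ< n k (≤-pred k≤n)) (χ<-0 (≤-pred k≤n))) (+-identityʳ (pred k))
... | inj₂ refl = ∑-χ<-below (suc n) (suc (suc n)) ≤-refl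

∑-χ≡ : ∀ n j → 1 ≤ j → j ≤ n → ∑ (λ v → χ≡ v j) n ≡ 1
∑-χ≡ n j p q = trans (∑-delta (λ v → χ≡ v j) n j p q (λ v _ _ → χ≡-0)) (χ≡-refl j)

-- Adjacent transpositions and the permutation of a word

τ : ℕ → ℕ → ℕ
τ a k = if k ≡ᵇ a then suc a else (if k ≡ᵇ suc a then a else k)

τ-fst : ∀ a → τ a a ≡ suc a
τ-fst a rewrite ≡ᵇ-refl a = refl

τ-snd : ∀ a → τ a (suc a) ≡ a
τ-snd a rewrite ≡ᵇ-false (≢-sym (<⇒≢ (n<1+n a))) | ≡ᵇ-refl a = refl

τ-fix : ∀ a k → k ≢ a → k ≢ suc a → τ a k ≡ k
τ-fix a k p q rewrite ≡ᵇ-false p | ≡ᵇ-false q = refl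

data TauView (a k : ℕ) : Set where
  fst   : k ≡ a → TauView a k
  snd   : k ≡ suc a → TauView a k
  fixed : k ≢ a → k ≢ suc a → TauView a k

tauView : ∀ a k → TauView a k
tauView a k with k ≟ a | k ≟ suc a
... | yes p | _     = fst p
... | no p  | yes q = snd q
... | no p  | no q  = fixed p q

τ-involutive : ∀ a k → τ a (τ a k) ≡ k
τ-involutive a k with tauView a k
... | fst refl    rewrite τ-fst a = τ-snd a
... | snd refl    rewrite τ-snd a = τ-fst a
... | fixed p q   rewrite τ-fix a k p q = τ-fix a k p q

τ-suc : ∀ a k → τ (suc a) (suc k) ≡ suc (τ a k)
τ-suc a k with tauView a k
... | fst refl  rewrite τ-fst a | τ-fst (suc a) = refl
... | snd refl  rewrite τ-snd a | τ-snd (suc a) = refl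
... | fixed p q rewrite τ-fix a k p q = τ-fix (suc a) (suc k) (λ e → p (suc-injective e)) (λ e → q (suc-injective e))

τ-pos : ∀ a k → 1 ≤ a → 1 ≤ k → 1 ≤ τ a k
τ-pos a k 1≤a 1≤k with tauView a k
... | fst refl  rewrite τ-fst a = s≤s z≤n
... | snd refl  rewrite τ-snd a = 1≤a
... | fixed p q rewrite τ-fix a k p q = 1≤k

τ-monotone : ∀ a u w → u < w → ¬ (u ≡ a × w ≡ suc a) → τ a u < τ a w
τ-monotone a u w u<w ≢pair with tauView a u | tauView a w
... | fst refl  | fst refl    = ⊥-elim (<-irrefl refl u<w)
... | fst refl  | snd refl    = ⊥-elim (≢pair (refl , refl))
... | fst refl  | fixed p q   rewrite τ-fst a | τ-fix a w p q = ≤∧≢⇒< u<w (≢-sym q)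
... | snd refl  | fst refl    = ⊥-elim (<⇒≱ u<w (n≤1+n a))
... | snd refl  | snd refl    = ⊥-elim (<-irrefl refl u<w)
... | snd refl  | fixed p q   rewrite τ-snd a | τ-fix a w p q = <-trans (n<1+n a) u<w
... | fixed p q | fst refl    rewrite τ-fst a | τ-fix a u p q = <-trans u<w (n<1+n a)
... | fixed p q | snd refl    rewrite τ-snd a | τ-fix a u p q = ≤∧≢⇒< (≤-pred u<w) p
... | fixed p q | fixed p' q' rewrite τ-fix a u p q | τ-fix a w p' q' = u<w

χ<-off-pairˡ : ∀ x a → x ≢ a → x ≢ suc a → χ< x a ≡ χ< x (suc a)
χ<-off-pairˡ x a p q with compareχ x a
... | χ-less r e _ _    rewrite e = sym (χ<-1 (≤-trans r (n≤1+n a)))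
... | χ-equal r _ _ _   = ⊥-elim (p r)
... | χ-greater r e _ _ rewrite e = sym (χ<-0 r)

χ<-off-pairʳ : ∀ x a → x ≢ a → x ≢ suc a → χ< a x ≡ χ< (suc a) x
χ<-off-pairʳ x a p q with compareχ x a
... | χ-less r _ e _    rewrite e = sym (χ<-0 (≤-trans (<⇒≤ r) (n≤1+n a)))
... | χ-equal r _ _ _   = ⊥-elim (p r)
... | χ-greater r _ e _ rewrite e = sym (χ<-1 (≤∧≢⇒< r (≢-sym q)))

Letter : ℕ → ℕ → Set
Letter n a = 1 ≤ a × a < n

τ-range : ∀ n a k → Letter n a → 1 ≤ k → k ≤ n → 1 ≤ τ a k × τ a k ≤ n
τ-range n a k (1≤a , a<n) 1≤k k≤n with tauView a k
... | fst refl  rewrite τ-fst a = s≤s z≤n , a<n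
... | snd refl  rewrite τ-snd a = 1≤a , ≤-trans (n≤1+n a) k≤n
... | fixed p q rewrite τ-fix a k p q = 1≤k , k≤n

∑-τ : ∀ (f : ℕ → ℕ) n a → Letter n a → ∑ (λ v → f (τ a v)) n ≡ ∑ f n
∑-τ f n a (1≤a , a<n) with m≤n⇒∃[o]m+o≡n a<n
... | (k , refl) = go a 1≤a k
  where
  go : ∀ a → 1 ≤ a → ∀ k → ∑ (λ v → f (τ a v)) (suc a + k) ≡ ∑ f (suc a + k)
  go (suc a) _ zero rewrite +-identityʳ a =
    begin
      ∑ (λ v → f (τ (suc a) v)) a + f (τ (suc a) (suc a)) + f (τ (suc a) (suc (suc a)))
    ≡⟨ cong₂ (λ x y → x + f y + f (τ (suc a) (suc (suc a))))
             (∑-cong _ _ a (λ v _ v≤a → cong f (τ-fix (suc a) v (<⇒≢ (s≤s v≤a)) (<⇒≢ (m≤n⇒m≤1+n (s≤s v≤a))))))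
             (τ-fst (suc a)) ⟩
      ∑ f a + f (suc (suc a)) + f (τ (suc a) (suc (suc a)))
    ≡⟨ cong (λ x → ∑ f a + f (suc (suc a)) + f x) (τ-snd (suc a)) ⟩
      ∑ f a + f (suc (suc a)) + f (suc a)
    ≡⟨ +-swapʳ (∑ f a) (f (suc (suc a))) (f (suc a)) ⟩
      ∑ f a + f (suc a) + f (suc (suc a))
    ∎
    where
    open ≡-Reasoning
    +-swapʳ : ∀ x y z → x + y + z ≡ x + z + y
    +-swapʳ = solve-∀
  go a 1≤a (suc k) rewrite +-suc a k =
    cong₂ _+_ (go a 1≤a k)
              (cong f (τ-fix a (suc (suc a + k)) (≢-sym (<⇒≢ (m≤n⇒m≤1+n (s≤s (m≤m+n a k)))))
                                                (≢-sym (<⇒≢ (s≤s (s≤s (m≤m+n a k)))))))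

perm : List ℕ → ℕ → ℕ
perm []      k = k
perm (a ∷ γ) k = τ a (perm γ k)

perm-++ : ∀ γ δ k → perm (γ ++ δ) k ≡ perm γ (perm δ k)
perm-++ []      δ k = refl
perm-++ (a ∷ γ) δ k = cong (τ a) (perm-++ γ δ k)

perm-∷ʳ : ∀ γ a k → perm (γ ++ [ a ]) k ≡ perm γ (τ a k)
perm-∷ʳ γ a k = perm-++ γ [ a ] k

perm-reverse-cancel : ∀ γ k → perm (reverse γ) (perm γ k) ≡ k
perm-reverse-cancel []      k = refl
perm-reverse-cancel (a ∷ γ) k rewrite unfold-reverse a γ | perm-∷ʳ (reverse γ) a (τ a (perm γ k))
  | τ-involutive a (perm γ k) = perm-reverse-cancel γ k

perm-cancel-reverse : ∀ γ k → perm γ (perm (reverse γ) k) ≡ k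
perm-cancel-reverse γ k =
  subst (λ g → perm g (perm (reverse γ) k) ≡ k) (reverse-involutive γ) (perm-reverse-cancel (reverse γ) k)

perm-injective : ∀ γ {u v} → perm γ u ≡ perm γ v → u ≡ v
perm-injective γ {u} {v} e =
  trans (sym (perm-reverse-cancel γ u)) (trans (cong (perm (reverse γ)) e) (perm-reverse-cancel γ v))

perm-range : ∀ n γ k → All (Letter n) γ → 1 ≤ k → k ≤ n → 1 ≤ perm γ k × perm γ k ≤ n
perm-range n []      k _          1≤k k≤n = 1≤k , k≤n
perm-range n (a ∷ γ) k (la ∷ lγ) 1≤k k≤n =
  let (p , q) = perm-range n γ k lγ 1≤k k≤n in τ-range n a (perm γ k) la p q

∑-perm : ∀ (f : ℕ → ℕ) n γ → All (Letter n) γ → ∑ (λ v → f (perm γ v)) n ≡ ∑ f n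
∑-perm f n []      _          = refl
∑-perm f n (a ∷ γ) (la ∷ lγ) = trans (∑-perm (λ v → f (τ a v)) n γ lγ) (∑-τ f n a la)

All-reverse : ∀ {P : ℕ → Set} γ → All P γ → All P (reverse γ)
All-reverse γ = All-resp-↭ (↭-sym (↭-reverse γ))

-- One-line notation

applyUpTo-cong : ∀ {A : Set} {f g : ℕ → A} → (∀ i → f i ≡ g i) → ∀ k → applyUpTo f k ≡ applyUpTo g k
applyUpTo-cong h zero    = refl
applyUpTo-cong h (suc k) = cong₂ _∷_ (h 0) (applyUpTo-cong (λ i → h (suc i)) k)

at-suc : ∀ x xs k → 1 ≤ k → at (x ∷ xs) (suc k) ≡ at xs k
at-suc x xs (suc k) _ = refl

swapAt-length : ∀ a w → length (swapAt a w) ≡ length w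
swapAt-length zero          w             = refl
swapAt-length (suc zero)    []            = refl
swapAt-length (suc zero)    (x ∷ [])      = refl
swapAt-length (suc zero)    (x ∷ y ∷ w)   = refl
swapAt-length (suc (suc a)) []            = refl
swapAt-length (suc (suc a)) (x ∷ w)       = cong suc (swapAt-length (suc a) w)

at-swapAt : ∀ a w k → 1 ≤ a → suc a ≤ length w → at (swapAt a w) k ≡ at w (τ a k)
at-swapAt (suc zero)    (x ∷ [])    k                   _ (s≤s ())
at-swapAt (suc zero)    (x ∷ y ∷ w) zero                _ _ = refl
at-swapAt (suc zero)    (x ∷ y ∷ w) (suc zero)          _ _ = refl
at-swapAt (suc zero)    (x ∷ y ∷ w) (suc (suc zero))    _ _ = refl
at-swapAt (suc zero)    (x ∷ y ∷ w) (suc (suc (suc k))) _ _ = refl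
at-swapAt (suc (suc a)) (x ∷ w)     zero                _ _ = refl
at-swapAt (suc (suc a)) (x ∷ w)     (suc zero)          _ _ = refl
at-swapAt (suc (suc a)) (x ∷ w)     (suc (suc k))       _ (s≤s a<w) = begin
  at (swapAt (suc a) w) (suc k)        ≡⟨ at-swapAt (suc a) w (suc k) (s≤s z≤n) a<w ⟩
  at w (τ (suc a) (suc k))             ≡⟨ at-suc x w _ (τ-pos (suc a) (suc k) (s≤s z≤n) (s≤s z≤n)) ⟨
  at (x ∷ w) (suc (τ (suc a) (suc k))) ≡⟨ cong (at (x ∷ w)) (τ-suc (suc a) (suc k)) ⟨
  at (x ∷ w) (τ (suc (suc a)) (suc (suc k))) ∎
  where open ≡-Reasoning

at-applyUpTo : ∀ (f : ℕ → ℕ) n k → 1 ≤ k → k ≤ n → at (applyUpTo f n) k ≡ f (pred k)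
at-applyUpTo f (suc n) (suc zero)    _ _       = refl
at-applyUpTo f (suc n) (suc (suc k)) _ (s≤s q) = at-applyUpTo (λ x → f (suc x)) n (suc k) (s≤s z≤n) q

at-idPerm : ∀ n k → 1 ≤ k → k ≤ n → at (idPerm n) k ≡ k
at-idPerm n (suc k) = at-applyUpTo suc n (suc k)

length-foldl-swapAt : ∀ w γ → length (foldl (λ w a → swapAt a w) w γ) ≡ length w
length-foldl-swapAt w []      = refl
length-foldl-swapAt w (a ∷ γ) = trans (length-foldl-swapAt (swapAt a w) γ) (swapAt-length a w)

at-foldl-swapAt : ∀ w γ k → All (Letter (length w)) γ → at (foldl (λ w a → swapAt a w) w γ) k ≡ at w (perm γ k)
at-foldl-swapAt w []      k _                   = refl
at-foldl-swapAt w (a ∷ γ) k ((1≤a , a<w) ∷ lγ) =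
  trans (at-foldl-swapAt (swapAt a w) γ k (subst (λ m → All (Letter m) γ) (sym (swapAt-length a w)) lγ))
        (at-swapAt a w (perm γ k) 1≤a a<w)

wordPerm-length : ∀ n γ → length (wordPerm n γ) ≡ n
wordPerm-length n γ = trans (length-foldl-swapAt (idPerm n) γ) (length-applyUpTo suc n)

wordPerm-at : ∀ n γ k → All (Letter n) γ → 1 ≤ k → k ≤ n → at (wordPerm n γ) k ≡ perm γ k
wordPerm-at n γ k lγ 1≤k k≤n =
  let (p , q) = perm-range n γ k lγ 1≤k k≤n
  in trans (at-foldl-swapAt (idPerm n) γ k (subst (λ m → All (Letter m) γ) (sym (length-applyUpTo suc n)) lγ))
           (at-idPerm n (perm γ k) p q)

wordPerm-∷ʳ : ∀ n γ a → wordPerm n (γ ++ [ a ]) ≡ swapAt a (wordPerm n γ)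
wordPerm-∷ʳ n γ a = foldl-++ (λ w a → swapAt a w) (idPerm n) γ [ a ]

-- Counting inversions

𝟙 : Bool → ℕ
𝟙 true  = 1
𝟙 false = 0

𝟙-<ᵇ : ∀ x y → 𝟙 (x <ᵇ y) ≡ χ< x y
𝟙-<ᵇ x       zero    = refl
𝟙-<ᵇ zero    (suc y) = refl
𝟙-<ᵇ (suc x) (suc y) = 𝟙-<ᵇ x y

module _ {A : Set} where

  length≡sum-map-1 : (xs : List A) → length xs ≡ sum (map (λ _ → 1) xs)
  length≡sum-map-1 []       = refl
  length≡sum-map-1 (x ∷ xs) = cong suc (length≡sum-map-1 xs)

  sum-map-filterᵇ : ∀ (p : A → Bool) (g : A → ℕ) xs →
    sum (map g (filterᵇ p xs)) ≡ sum (map (λ x → 𝟙 (p x) * g x) xs)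
  sum-map-filterᵇ p g []       = refl
  sum-map-filterᵇ p g (x ∷ xs) with p x
  ... | true  = cong₂ _+_ (sym (+-identityʳ (g x))) (sum-map-filterᵇ p g xs)
  ... | false = sum-map-filterᵇ p g xs

  sum-map-cartesianProduct : ∀ {B : Set} (g : A × B → ℕ) xs ys →
    sum (map g (cartesianProduct xs ys)) ≡ sum (map (λ x → sum (map (λ y → g (x , y)) ys)) xs)
  sum-map-cartesianProduct g []       ys = refl
  sum-map-cartesianProduct g (x ∷ xs) ys = begin
    sum (map g (map (x ,_) ys ++ cartesianProduct xs ys))
      ≡⟨ cong sum (map-++ g (map (x ,_) ys) _) ⟩
    sum (map g (map (x ,_) ys) ++ map g (cartesianProduct xs ys))
      ≡⟨ sum-++ (map g (map (x ,_) ys)) _ ⟩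
    sum (map g (map (x ,_) ys)) + sum (map g (cartesianProduct xs ys))
      ≡⟨ cong₂ _+_ (cong sum (sym (map-∘ ys))) (sum-map-cartesianProduct g xs ys) ⟩
    sum (map (λ y → g (x , y)) ys) + sum (map (λ x → sum (map (λ y → g (x , y)) ys)) xs) ∎
    where open ≡-Reasoning

sum-map-idPerm : ∀ (f : ℕ → ℕ) n → sum (map f (idPerm n)) ≡ ∑ f n
sum-map-idPerm f zero    = refl
sum-map-idPerm f (suc n) = begin
  sum (map f (idPerm (suc n)))                ≡⟨ cong (sum ∘ map f) (applyUpTo-∷ʳ suc n) ⟨
  sum (map f (idPerm n ++ [ suc n ]))         ≡⟨ cong sum (map-++ f (idPerm n) [ suc n ]) ⟩
  sum (map f (idPerm n) ++ [ f (suc n) ])     ≡⟨ sum-++ (map f (idPerm n)) [ f (suc n) ] ⟩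
  sum (map f (idPerm n)) + (f (suc n) + 0)    ≡⟨ cong₂ _+_ (sum-map-idPerm f n) (+-identityʳ (f (suc n))) ⟩
  ∑ f (suc n)                                 ∎
  where open ≡-Reasoning

inv-∑∑ : ∀ n w → inv n w ≡ ∑ (λ i → ∑ (λ j → χ< i j * χ< (at w j) (at w i)) n) n
inv-∑∑ n w = begin
  length (filterᵇ Q (filterᵇ P I×I))
    ≡⟨ length≡sum-map-1 (filterᵇ Q (filterᵇ P I×I)) ⟩
  sum (map (λ _ → 1) (filterᵇ Q (filterᵇ P I×I)))
    ≡⟨ sum-map-filterᵇ Q (λ _ → 1) (filterᵇ P I×I) ⟩
  sum (map (λ x → 𝟙 (Q x) * 1) (filterᵇ P I×I))
    ≡⟨ sum-map-filterᵇ P _ I×I ⟩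
  sum (map g I×I)
    ≡⟨ sum-map-cartesianProduct g I I ⟩
  sum (map (λ i → sum (map (λ j → g (i , j)) I)) I)
    ≡⟨ cong sum (map-cong (λ i → sum-map-idPerm (λ j → g (i , j)) n) I) ⟩
  sum (map (λ i → ∑ (λ j → g (i , j)) n) I)
    ≡⟨ sum-map-idPerm _ n ⟩
  ∑ (λ i → ∑ (λ j → g (i , j)) n) n
    ≡⟨ ∑-cong _ _ n (λ i _ _ → ∑-cong _ _ n (λ j _ _ → g≡ i j)) ⟩
  ∑ (λ i → ∑ (λ j → χ< i j * χ< (at w j) (at w i)) n) n ∎
  where
  open ≡-Reasoning
  I = idPerm n
  I×I = cartesianProduct I I
  P Q : ℕ × ℕ → Bool
  P (i , j) = i <ᵇ j
  Q (i , j) = at w j <ᵇ at w i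
  g : ℕ × ℕ → ℕ
  g x = 𝟙 (P x) * (𝟙 (Q x) * 1)
  g≡ : ∀ i j → g (i , j) ≡ χ< i j * χ< (at w j) (at w i)
  g≡ i j = cong₂ _*_ (𝟙-<ᵇ i j) (trans (*-identityʳ _) (𝟙-<ᵇ (at w j) (at w i)))

smallerThan : ℕ → List ℕ → ℕ
smallerThan x []       = 0
smallerThan x (y ∷ ys) = χ< y x + smallerThan x ys

inversions : List ℕ → ℕ
inversions []       = 0
inversions (x ∷ xs) = smallerThan x xs + inversions xs

∑-shift : ∀ (f : ℕ → ℕ) m → ∑ f (suc m) ≡ f 1 + ∑ (λ i → f (suc i)) m
∑-shift f zero    = +-comm 0 (f 1)
∑-shift f (suc m) = trans (cong (_+ f (suc (suc m))) (∑-shift f m)) (+-assoc (f 1) _ _)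

smallerThan-∑ : ∀ x ys → ∑ (λ j → χ< (at ys j) x) (length ys) ≡ smallerThan x ys
smallerThan-∑ x []       = refl
smallerThan-∑ x (y ∷ ys) =
  trans (∑-shift _ (length ys))
        (cong (χ< y x +_) (trans (∑-cong _ _ (length ys) (λ j 1≤j _ → cong (λ z → χ< z x) (at-suc y ys j 1≤j)))
                                 (smallerThan-∑ x ys)))

inversions-∑∑ : ∀ w → inversions w ≡ ∑ (λ i → ∑ (λ j → χ< i j * χ< (at w j) (at w i)) (length w)) (length w)
inversions-∑∑ []       = refl
inversions-∑∑ (x ∷ xs) = sym (trans (∑-shift _ m) (cong₂ _+_ firstRow otherRows))
  where
  m = length xs
  w = x ∷ xs
  firstRow : ∑ (λ j → χ< 1 j * χ< (at w j) (at w 1)) (suc m) ≡ smallerThan x xs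
  firstRow = trans (∑-shift _ m) (trans (∑-cong _ _ m (λ { (suc j) _ _ → +-identityʳ _ })) (smallerThan-∑ x xs))
  otherRows : ∑ (λ i → ∑ (λ j → χ< (suc i) j * χ< (at w j) (at w (suc i))) (suc m)) m ≡ inversions xs
  otherRows = trans (∑-cong _ _ m (λ { (suc i) _ _ → trans (∑-shift _ m) (∑-cong _ _ m (λ { (suc j) _ _ → refl })) }))
                    (sym (inversions-∑∑ xs))

inv≡inversions : ∀ n w → length w ≡ n → inv n w ≡ inversions w
inv≡inversions n w refl = trans (inv-∑∑ (length w) w) (sym (inversions-∑∑ w))

smallerThan-swapAt : ∀ a x w → smallerThan x (swapAt a w) ≡ smallerThan x w
smallerThan-swapAt zero          x w           = refl
smallerThan-swapAt (suc zero)    x []          = refl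
smallerThan-swapAt (suc zero)    x (y ∷ [])    = refl
smallerThan-swapAt (suc zero)    x (y ∷ z ∷ w) = +-exchange (χ< z x) (χ< y x) (smallerThan x w)
  where
  +-exchange : ∀ a b c → a + (b + c) ≡ b + (a + c)
  +-exchange = solve-∀
smallerThan-swapAt (suc (suc a)) x []          = refl
smallerThan-swapAt (suc (suc a)) x (y ∷ w)     = cong (χ< y x +_) (smallerThan-swapAt (suc a) x w)

-- Stated with the indicators of both orders so that no subtraction occurs.
inversions-swapAt : ∀ a w → 1 ≤ a → suc a ≤ length w →
  inversions (swapAt a w) + χ< (at w (suc a)) (at w a) ≡ inversions w + χ< (at w a) (at w (suc a))
inversions-swapAt (suc zero)    (x ∷ [])    _ (s≤s ())
inversions-swapAt (suc zero)    (x ∷ y ∷ w) _ _ =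
  rearrange (χ< x y) (smallerThan y w) (smallerThan x w) (inversions w) (χ< y x)
  where
  rearrange : ∀ A B C D E → (A + B) + (C + D) + E ≡ (E + C) + (B + D) + A
  rearrange = solve-∀
inversions-swapAt (suc (suc a)) (x ∷ w)     _ (s≤s a<w) =
  trans (+-assoc (smallerThan x (swapAt (suc a) w)) _ _)
        (trans (cong₂ _+_ (smallerThan-swapAt (suc a) x w) (inversions-swapAt (suc a) w (s≤s z≤n) a<w))
               (sym (+-assoc (smallerThan x w) _ _)))

inversions-idPerm : ∀ n → inversions (idPerm n) ≡ 0
inversions-idPerm n = go 1 n
  where
  none-smaller : ∀ x (f : ℕ → ℕ) k → (∀ i → x < f i) → smallerThan x (applyUpTo f k) ≡ 0
  none-smaller x f zero    h = refl
  none-smaller x f (suc k) h rewrite χ<-0 (<⇒≤ (h 0)) = none-smaller x (λ i → f (suc i)) k (λ i → h (suc i))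
  go : ∀ m k → inversions (applyUpTo (m +_) k) ≡ 0
  go m zero    = refl
  go m (suc k) =
    cong₂ _+_ (none-smaller (m + 0) (λ i → m + suc i) k (λ i → +-monoʳ-< m (s≤s z≤n)))
              (trans (cong inversions (applyUpTo-cong (λ i → +-suc m i) k)) (go (suc m) k))

-- Reduced words consist of ascents

Ascents : List ℕ → List ℕ → Set
Ascents π []      = ⊤
Ascents π (a ∷ σ) = perm π a < perm π (suc a) × Ascents (π ++ [ a ]) σ

module _ (n : ℕ) where

  private
    invs : List ℕ → ℕ
    invs π = inversions (wordPerm n π)

  inversions-∷ʳ : ∀ π a → All (Letter n) π → Letter n a →
    invs (π ++ [ a ]) + χ< (perm π (suc a)) (perm π a) ≡ invs π + χ< (perm π a) (perm π (suc a))
  inversions-∷ʳ π a lπ (1≤a , a<n)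
    rewrite sym (wordPerm-at n π a lπ 1≤a (≤-trans (n≤1+n a) a<n))
          | sym (wordPerm-at n π (suc a) lπ (s≤s z≤n) a<n)
          | wordPerm-∷ʳ n π a
    = inversions-swapAt a (wordPerm n π) 1≤a (subst (suc a ≤_) (sym (wordPerm-length n π)) a<n)

  inversions-∷ʳ-≤ : ∀ π a → All (Letter n) π → Letter n a → invs (π ++ [ a ]) ≤ suc (invs π)
  inversions-∷ʳ-≤ π a lπ la = begin
    invs (π ++ [ a ])                                   ≤⟨ m≤m+n _ _ ⟩
    invs (π ++ [ a ]) + χ< (perm π (suc a)) (perm π a)  ≡⟨ inversions-∷ʳ π a lπ la ⟩
    invs π + χ< (perm π a) (perm π (suc a))             ≤⟨ +-monoʳ-≤ (invs π) (χ<-≤1 (perm π a) (perm π (suc a))) ⟩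
    invs π + 1                                          ≡⟨ +-comm (invs π) 1 ⟩
    suc (invs π)                                        ∎
    where open ≤-Reasoning

  inversions-++-≤ : ∀ π σ → All (Letter n) π → All (Letter n) σ → invs (π ++ σ) ≤ invs π + length σ
  inversions-++-≤ π []      _  _          = ≤-reflexive (trans (cong invs (++-identityʳ π)) (sym (+-identityʳ _)))
  inversions-++-≤ π (a ∷ σ) lπ (la ∷ lσ) = begin
    invs (π ++ a ∷ σ)             ≡⟨ cong invs (++-assoc π [ a ] σ) ⟨
    invs ((π ++ [ a ]) ++ σ)      ≤⟨ inversions-++-≤ (π ++ [ a ]) σ (All-++⁺ lπ (la ∷ [])) lσ ⟩
    invs (π ++ [ a ]) + length σ  ≤⟨ +-monoˡ-≤ (length σ) (inversions-∷ʳ-≤ π a lπ la) ⟩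
    suc (invs π) + length σ       ≡⟨ +-suc (invs π) (length σ) ⟨
    invs π + length (a ∷ σ)       ∎
    where open ≤-Reasoning

  -- Each letter raises the inversion number by at most one, so if σ raises it by
  -- exactly length σ then every letter raises it by one, i.e. is an ascent.
  ascents-of-tight : ∀ π σ → All (Letter n) π → All (Letter n) σ →
    invs (π ++ σ) ≡ invs π + length σ → Ascents π σ
  ascents-of-tight π []      _  _          _     = tt
  ascents-of-tight π (a ∷ σ) lπ (la ∷ lσ) tight =
    χ<≡1⇒< (perm π a) (perm π (suc a)) ascent , ascents-of-tight (π ++ [ a ]) σ lπa lσ tight′
    where
    lπa = All-++⁺ lπ (la ∷ [])
    k = length σ
    step : suc (invs π) ≤ invs (π ++ [ a ])
    step = +-cancelʳ-≤ k _ _ (begin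
      suc (invs π) + k          ≡⟨ +-suc (invs π) k ⟨
      invs π + suc k            ≡⟨ tight ⟨
      invs (π ++ a ∷ σ)         ≡⟨ cong invs (++-assoc π [ a ] σ) ⟨
      invs ((π ++ [ a ]) ++ σ)  ≤⟨ inversions-++-≤ (π ++ [ a ]) σ lπa lσ ⟩
      invs (π ++ [ a ]) + k     ∎)
      where open ≤-Reasoning
    ascent : χ< (perm π a) (perm π (suc a)) ≡ 1
    ascent = ≤-antisym (χ<-≤1 (perm π a) (perm π (suc a))) (+-cancelˡ-≤ (invs π) 1 _ (begin
      invs π + 1                                             ≡⟨ +-comm (invs π) 1 ⟩
      suc (invs π)                                           ≤⟨ step ⟩
      invs (π ++ [ a ])                                      ≤⟨ m≤m+n _ _ ⟩
      invs (π ++ [ a ]) + χ< (perm π (suc a)) (perm π a)     ≡⟨ inversions-∷ʳ π a lπ la ⟩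
      invs π + χ< (perm π a) (perm π (suc a))                ∎))
      where open ≤-Reasoning
    tight′ : invs ((π ++ [ a ]) ++ σ) ≡ invs (π ++ [ a ]) + k
    tight′ = begin
      invs ((π ++ [ a ]) ++ σ)  ≡⟨ cong invs (++-assoc π [ a ] σ) ⟩
      invs (π ++ a ∷ σ)         ≡⟨ tight ⟩
      invs π + suc k            ≡⟨ +-suc (invs π) k ⟩
      suc (invs π) + k          ≡⟨ cong (_+ k) (≤-antisym (inversions-∷ʳ-≤ π a lπ la) step) ⟨
      invs (π ++ [ a ]) + k     ∎
      where open ≡-Reasoning

  reduced⇒ascents : ∀ ω α → IsReducedWord n ω α → Ascents [] α
  reduced⇒ascents ω α (lα , α↦ω , ℓα) = ascents-of-tight [] α [] lα (begin
    inversions (wordPerm n α)  ≡⟨ inv≡inversions n (wordPerm n α) (wordPerm-length n α) ⟨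
    inv n (wordPerm n α)       ≡⟨ cong (inv n) α↦ω ⟩
    inv n ω                    ≡⟨ ℓα ⟨
    length α                   ≡⟨ cong (_+ length α) (inversions-idPerm n) ⟨
    invs [] + length α         ∎)
    where open ≡-Reasoning

ascents-split : ∀ π γ a δ → Ascents π (γ ++ a ∷ δ) →
  perm (π ++ γ) a < perm (π ++ γ) (suc a) × Ascents ((π ++ γ) ++ [ a ]) δ
ascents-split π []      a δ asc rewrite ++-identityʳ π = asc
ascents-split π (x ∷ γ) a δ (_ , asc) rewrite sym (++-assoc π [ x ] γ) = ascents-split (π ++ [ x ]) γ a δ asc

ascents-intro : ∀ π σ → (∀ σ₁ a σ₂ → σ ≡ σ₁ ++ a ∷ σ₂ → perm (π ++ σ₁) a < perm (π ++ σ₁) (suc a)) → Ascents π σ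
ascents-intro π []      h = tt
ascents-intro π (a ∷ σ) h =
  subst (λ z → perm z a < perm z (suc a)) (++-identityʳ π) (h [] a σ refl) ,
  ascents-intro (π ++ [ a ]) σ (λ σ₁ b σ₂ e →
    subst (λ z → perm z b < perm z (suc b)) (sym (++-assoc π [ a ] σ₁)) (h (a ∷ σ₁) b σ₂ (cong (a ∷_) e)))

reverse-∷ʳ : ∀ (π : List ℕ) a → reverse (π ++ [ a ]) ≡ a ∷ reverse π
reverse-∷ʳ π a = reverse-++ π [ a ]

-- In the inverse permutation, ascents never undo an inversion.
inverse-inversion-persists : ∀ π δ x y → Ascents π δ → y < x →
  perm (reverse π) x < perm (reverse π) y → perm (reverse (π ++ δ)) x < perm (reverse (π ++ δ)) y
inverse-inversion-persists π []      x y _          y<x inverted rewrite ++-identityʳ π = inverted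
inverse-inversion-persists π (d ∷ δ) x y (asc , as) y<x inverted =
  subst (λ z → perm (reverse z) x < perm (reverse z) y) (++-assoc π [ d ] δ)
        (inverse-inversion-persists (π ++ [ d ]) δ x y as y<x inverted′)
  where
  inverted′ : perm (reverse (π ++ [ d ])) x < perm (reverse (π ++ [ d ])) y
  inverted′ rewrite reverse-∷ʳ π d = τ-monotone d _ _ inverted λ { (e₁ , e₂) → <-asym y<x
    (subst₂ _<_ (trans (cong (perm π) (sym e₁)) (perm-cancel-reverse π x))
                (trans (cong (perm π) (sym e₂)) (perm-cancel-reverse π y)) asc) }

perm-reverse-split : ∀ γ a δ k → perm (reverse (γ ++ a ∷ δ)) (perm γ k) ≡ perm (reverse δ) (τ a k)
perm-reverse-split γ a δ k = begin
  perm (reverse (γ ++ a ∷ δ)) (perm γ k)                      ≡⟨ cong (λ z → perm (reverse z) (perm γ k)) (++-assoc γ [ a ] δ) ⟨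
  perm (reverse ((γ ++ [ a ]) ++ δ)) (perm γ k)               ≡⟨ cong (λ z → perm z (perm γ k)) (reverse-++ (γ ++ [ a ]) δ) ⟩
  perm (reverse δ ++ reverse (γ ++ [ a ])) (perm γ k)         ≡⟨ perm-++ (reverse δ) _ (perm γ k) ⟩
  perm (reverse δ) (perm (reverse (γ ++ [ a ])) (perm γ k))   ≡⟨ cong (λ z → perm (reverse δ) (perm z (perm γ k))) (reverse-∷ʳ γ a) ⟩
  perm (reverse δ) (τ a (perm (reverse γ) (perm γ k)))        ≡⟨ cong (λ z → perm (reverse δ) (τ a z)) (perm-reverse-cancel γ k) ⟩
  perm (reverse δ) (τ a k)                                    ∎
  where open ≡-Reasoning

ascent-of-suffix-inverse : ∀ γ a δ → Ascents [] (γ ++ a ∷ δ) → perm (reverse δ) a < perm (reverse δ) (suc a)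
ascent-of-suffix-inverse γ a δ asc =
  subst₂ _<_ (trans (cong (λ z → perm (reverse z) b) (++-assoc γ [ a ] δ))
                    (trans (perm-reverse-split γ a δ (suc a)) (cong (perm (reverse δ)) (τ-snd a))))
             (trans (cong (λ z → perm (reverse z) c) (++-assoc γ [ a ] δ))
                    (trans (perm-reverse-split γ a δ a) (cong (perm (reverse δ)) (τ-fst a))))
             (inverse-inversion-persists (γ ++ [ a ]) δ b c (proj₂ split) (proj₁ split) inverted)
  where
  split = ascents-split [] γ a δ asc
  b = perm γ (suc a)
  c = perm γ a
  inverted : perm (reverse (γ ++ [ a ])) b < perm (reverse (γ ++ [ a ])) c
  inverted rewrite reverse-∷ʳ γ a | perm-reverse-cancel γ (suc a) | perm-reverse-cancel γ a
                 | τ-snd a | τ-fst a = n<1+n a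

ascents-reverse : ∀ α → Ascents [] α → Ascents [] (reverse α)
ascents-reverse α asc = ascents-intro [] (reverse α) λ σ₁ a σ₂ e →
  subst (λ z → perm z a < perm z (suc a)) (reverse-involutive σ₁)
        (ascent-of-suffix-inverse (reverse σ₂) a (reverse σ₁) (subst (Ascents []) (split e) asc))
  where
  open ≡-Reasoning
  split : ∀ {σ₁ a σ₂} → reverse α ≡ σ₁ ++ a ∷ σ₂ → α ≡ reverse σ₂ ++ a ∷ reverse σ₁
  split {σ₁} {a} {σ₂} e = begin
    α                                    ≡⟨ reverse-involutive α ⟨
    reverse (reverse α)                  ≡⟨ cong reverse e ⟩
    reverse (σ₁ ++ a ∷ σ₂)               ≡⟨ reverse-++ σ₁ (a ∷ σ₂) ⟩
    reverse (a ∷ σ₂) ++ reverse σ₁       ≡⟨ cong (_++ reverse σ₁) (unfold-reverse a σ₂) ⟩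
    (reverse σ₂ ++ [ a ]) ++ reverse σ₁  ≡⟨ ++-assoc (reverse σ₂) [ a ] (reverse σ₁) ⟩
    reverse σ₂ ++ a ∷ reverse σ₁         ∎

-- Sliding along a diagonal

applyUpTo-+-suc : ∀ p k → applyUpTo (p +_) (suc k) ≡ p ∷ applyUpTo (suc p +_) k
applyUpTo-+-suc p k = cong₂ _∷_ (+-identityʳ p) (applyUpTo-cong (+-suc p) k)

head-filterᵇ-range-just : ∀ (P : ℕ → Bool) k p q → p ≤ q → q < p + k → P q ≡ true →
  (∀ t → p ≤ t → t < q → P t ≡ false) → head (filterᵇ P (applyUpTo (p +_) k)) ≡ just q
head-filterᵇ-range-just P zero    p q p≤q q<p+k _  _    = ⊥-elim (<⇒≱ q<p+k (subst (_≤ q) (sym (+-identityʳ p)) p≤q))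
head-filterᵇ-range-just P (suc k) p q p≤q q<p+k Pq skip =
  trans (cong (head ∘ filterᵇ P) (applyUpTo-+-suc p k)) (first (m≤n⇒m<n∨m≡n p≤q))
  where
  first : p < q ⊎ p ≡ q → head (filterᵇ P (p ∷ applyUpTo (suc p +_) k)) ≡ just q
  first (inj₂ refl) rewrite Pq = refl
  first (inj₁ p<q)  rewrite skip p ≤-refl p<q =
    head-filterᵇ-range-just P k (suc p) q p<q (subst (q <_) (+-suc p k) q<p+k) Pq (λ t p<t → skip t (<⇒≤ p<t))

head-filterᵇ-range-nothing : ∀ (P : ℕ → Bool) k p → (∀ t → p ≤ t → t < p + k → P t ≡ false) →
  head (filterᵇ P (applyUpTo (p +_) k)) ≡ nothing
head-filterᵇ-range-nothing P zero    p none = refl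
head-filterᵇ-range-nothing P (suc k) p none = trans (cong (head ∘ filterᵇ P) (applyUpTo-+-suc p k)) rest
  where
  rest : head (filterᵇ P (p ∷ applyUpTo (suc p +_) k)) ≡ nothing
  rest rewrite none p ≤-refl (subst (p <_) (sym (+-suc p k)) (s≤s (m≤m+n p k))) =
    head-filterᵇ-range-nothing P k (suc p) (λ t p<t t<p+k → none t (<⇒≤ p<t) (subst (t <_) (sym (+-suc p k)) t<p+k))

-- Tower t meets the diagonal x + y = d iff t ≤ d < t + size D t.
∸<ᵇ-true : ∀ d t k → t ≤ d → d < t + k → ((d ∸ t) <ᵇ k) ≡ true
∸<ᵇ-true d       zero    k _       d<k       = <ᵇ-true d<k
∸<ᵇ-true (suc d) (suc t) k (s≤s t≤d) (s≤s d<) = ∸<ᵇ-true d t k t≤d d<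

∸<ᵇ-false : ∀ d t k → t + k ≤ d → ((d ∸ t) <ᵇ k) ≡ false
∸<ᵇ-false d       zero    k t+k≤d        = <ᵇ-false t+k≤d
∸<ᵇ-false (suc d) (suc t) k (s≤s t+k≤d)  = ∸<ᵇ-false d t k t+k≤d

∸+2≤ : ∀ d t k → t ≤ d → suc (suc d) ≤ t + k → suc (suc (d ∸ t)) ≤ k
∸+2≤ d       zero    k _         d+2≤k         = d+2≤k
∸+2≤ (suc d) (suc t) k (s≤s t≤d) (s≤s d+2≤t+k) = ∸+2≤ d t k t≤d d+2≤t+k

size-pos⇒≤length : ∀ D t → 1 ≤ size D t → t ≤ length D
size-pos⇒≤length (x ∷ D) (suc zero)    _ = s≤s z≤n
size-pos⇒≤length (x ∷ D) (suc (suc t)) p = s≤s (size-pos⇒≤length D (suc t) p)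

module _ (D : TowerDiagram) where

  leftmostOn-just : ∀ p q d → p ≤ q → q ≤ d → d < q + size D q →
    (∀ t → p ≤ t → t < q → t + size D t ≤ d) → leftmostOn D p d ≡ just q
  leftmostOn-just p q d p≤q q≤d meets below =
    head-filterᵇ-range-just _ (suc d ∸ p) p q p≤q
      (subst (q <_) (sym (m+[n∸m]≡n (≤-trans p≤q (m≤n⇒m≤1+n q≤d)))) (s≤s q≤d))
      (∸<ᵇ-true d q (size D q) q≤d meets)
      (λ t p≤t t<q → ∸<ᵇ-false d t (size D t) (below t p≤t t<q))

  leftmostOn-nothing : ∀ p d → (∀ t → p ≤ t → t ≤ d → t + size D t ≤ d) → leftmostOn D p d ≡ nothing
  leftmostOn-nothing p d below = head-filterᵇ-range-nothing _ (suc d ∸ p) p λ t p≤t t<end →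
    ∸<ᵇ-false d t (size D t) (below t p≤t (≤-pred (in-range t p≤t t<end)))
    where
    in-range : ∀ t → p ≤ t → t < p + (suc d ∸ p) → t < suc d
    in-range t p≤t t<end with p ≤? suc d
    ... | yes p≤d = subst (t <_) (m+[n∸m]≡n p≤d) t<end
    ... | no  p≰d = ⊥-elim (<⇒≱ (subst (t <_) empty t<end) p≤t)
      where empty = trans (cong (p +_) (m≤n⇒m∸n≡0 (<⇒≤ (≰⇒> p≰d)))) (+-identityʳ p)

  private
    pred< : ∀ {q d} → q < d → pred d < d
    pred< {d = suc d} _ = ≤-refl

    ends⇒∸ : ∀ {q d} → q + size D q ≡ d → d ∸ q ≡ size D q
    ends⇒∸ {q} refl = m+n∸m≡n q (size D q)

    below-pred : ∀ {p q d} → (∀ t → p ≤ t → t < q → suc (t + size D t) ≤ d) →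
      ∀ t → p ≤ t → t < q → t + size D t ≤ pred d
    below-pred below t p≤t t<q = <⇒≤pred (below t p≤t t<q)

    nothing-before : ∀ p q → 1 ≤ q → (∀ t → p ≤ t → t < q → suc (t + size D t) ≤ q) →
      leftmostOn D p (pred q) ≡ nothing
    nothing-before p (suc q) _ below =
      leftmostOn-nothing p q (λ t p≤t t≤q → ≤-pred (below t p≤t (s≤s t≤q)))

  -- Rule (S2a) at tower q, or (S1a) when q = d.
  slideF-adds : ∀ f p q d → 1 ≤ p → p ≤ q → q + size D q ≡ d →
    (∀ t → p ≤ t → t < q → suc (t + size D t) ≤ d) → slideF (suc f) D p d ≡ just (q , size D q)
  slideF-adds f p q d 1≤p p≤q ends below with m≤n⇒m<n∨m≡n (subst (q ≤_) ends (m≤m+n q (size D q)))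
  ... | inj₁ q<d
    rewrite leftmostOn-just p q (pred d) p≤q (<⇒≤pred q<d)
              (subst (pred d <_) (sym ends) (pred< q<d))
              (below-pred below)
          | ≤ᵇ-true (≤-reflexive (sym (ends⇒∸ ends))) = cong (λ k → just (q , k)) (ends⇒∸ ends)
  ... | inj₂ refl
    rewrite nothing-before p q (≤-trans 1≤p p≤q) below
          | leftmostOn-nothing p q (λ t p≤t t≤q → [ (λ t<q → <⇒≤ (below t p≤t t<q)) , (λ { refl → ≤-reflexive ends }) ]′
                                                    (m≤n⇒m<n∨m≡n t≤q))
    = cong (λ k → just (q , k)) (sym (+-cancelˡ-≡ q (size D q) 0 (trans ends (sym (+-identityʳ q)))))

  -- Rule (S2c) at tower q, or (S1c) when q = d.
  slideF-passes : ∀ f p q d → 1 ≤ p → p ≤ q → q ≤ d → suc (suc d) ≤ q + size D q →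
    (∀ t → p ≤ t → t < q → suc (t + size D t) ≤ d) → slideF (suc f) D p d ≡ slideF f D (suc q) (suc d)
  slideF-passes f p q d 1≤p p≤q q≤d high below with m≤n⇒m<n∨m≡n q≤d
  ... | inj₁ q<d
    rewrite leftmostOn-just p q (pred d) p≤q (<⇒≤pred q<d) (≤-trans (s≤s (pred[n]≤n {d})) (≤-trans (n≤1+n (suc d)) high))
              (below-pred below)
          | ≤ᵇ-false (≤-trans (n≤1+n _) (∸+2≤ d q (size D q) q≤d high))
          | ≤ᵇ-false (∸+2≤ d q (size D q) q≤d high) = refl
  ... | inj₂ refl
    rewrite nothing-before p q (≤-trans 1≤p p≤q) below
          | leftmostOn-just p q q p≤q ≤-refl (≤-trans (n≤1+n (suc q)) high) (λ t p≤t t<q → <⇒≤ (below t p≤t t<q))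
          | ≤ᵇ-true (+-cancelˡ-≤ q 2 (size D q) (subst (_≤ q + size D q) (+-comm 2 q) high)) = refl

-- Positions of values and the code of the inverse permutation

-- The number of values v > t placed before t in the one-line notation of w_π;
-- perm (reverse π) = w_π⁻¹ sends a value to its position.
code : ℕ → List ℕ → ℕ → ℕ
code n π t = ∑ (λ v → χ< t v * χ< (perm (reverse π) v) (perm (reverse π) t)) n

module Positions (n : ℕ) (π : List ℕ) (lπ : All (Letter n) π) where

  pos : ℕ → ℕ
  pos = perm (reverse π)

  pos-injective : ∀ {u v} → pos u ≡ pos v → u ≡ v
  pos-injective = perm-injective (reverse π)

  pos-range : ∀ t → 1 ≤ t → t ≤ n → 1 ≤ pos t × pos t ≤ n
  pos-range t = perm-range n (reverse π) t (All-reverse π lπ)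

  positions-below : ∀ k → k ≤ suc n → ∑ (λ v → χ< (pos v) k) n ≡ pred k
  positions-below k k≤ = trans (∑-perm (λ x → χ< x k) n (reverse π) (All-reverse π lπ)) (∑-χ< n k k≤)

  positions-between : ∀ x y → 1 ≤ x → x < y → y ≤ n →
    ∑ (λ v → χ< x (pos v) * χ< (pos v) y) n + suc x ≡ y
  positions-between x y 1≤x x<y y≤n = begin
    between + suc x                                 ≡⟨ cong (λ z → between + suc z) (suc-pred x {{>-nonZero 1≤x}}) ⟨
    between + suc (suc (pred x))                    ≡⟨ rearrange between (pred x) ⟩
    suc (pred x + 1 + between)                      ≡⟨ cong (λ z → suc (z + 1 + between)) (positions-below x (m≤n⇒m≤1+n x≤n)) ⟨
    suc (below-x + 1 + between)                     ≡⟨ cong (λ z → suc (below-x + z + between)) at-x ⟨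
    suc (below-x + at-x′ + between)                 ≡⟨ cong (λ z → suc (z + between)) (∑-distrib-+ _ _ n) ⟨
    suc (∑ (λ v → χ< (pos v) x + χ≡ (pos v) x) n + between)
                                                    ≡⟨ cong suc (∑-distrib-+ _ _ n) ⟨
    suc (∑ (λ v → χ< (pos v) x + χ≡ (pos v) x + χ< x (pos v) * χ< (pos v) y) n)
                                                    ≡⟨ cong suc (∑-cong _ _ n (λ v _ _ → split (pos v))) ⟨
    suc (∑ (λ v → χ< (pos v) y) n)                  ≡⟨ cong suc (positions-below y (m≤n⇒m≤1+n y≤n)) ⟩
    suc (pred y)                                    ≡⟨ suc-pred y {{>-nonZero (≤-trans 1≤x (<⇒≤ x<y))}} ⟩
    y                                               ∎
    where
    open ≡-Reasoning
    x≤n = ≤-trans (<⇒≤ x<y) y≤n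
    between = ∑ (λ v → χ< x (pos v) * χ< (pos v) y) n
    below-x = ∑ (λ v → χ< (pos v) x) n
    at-x′ = ∑ (λ v → χ≡ (pos v) x) n
    at-x : at-x′ ≡ 1
    at-x = trans (∑-perm (λ u → χ≡ u x) n (reverse π) (All-reverse π lπ)) (∑-χ≡ n x 1≤x x≤n)
    rearrange : ∀ z p → z + suc (suc p) ≡ suc (p + 1 + z)
    rearrange = solve-∀
    split : ∀ u → χ< u y ≡ χ< u x + χ≡ u x + χ< x u * χ< u y
    split u with compareχ u x
    ... | χ-less u<x e₁ e₂ e₃    rewrite e₁ | e₂ | e₃ = χ<-1 (<-trans u<x x<y)
    ... | χ-equal refl e₁ e₂ e₃  rewrite e₁ | e₂ | e₃ = χ<-1 x<y
    ... | χ-greater _ e₁ e₂ e₃   rewrite e₁ | e₂ | e₃ = sym (+-identityʳ _)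

  smallerAfter : ℕ → ℕ
  smallerAfter t = ∑ (λ v → χ< v t * χ< (pos t) (pos v)) n

  -- Split the pos t − 1 values placed before t, and the t − 1 values smaller than t,
  -- according to the other comparison; the values smaller than t and placed before it are common.
  code-balance : ∀ t → 1 ≤ t → t ≤ n → t + code n π t ≡ pos t + smallerAfter t
  code-balance t 1≤t t≤n = begin
    t + code n π t                                      ≡⟨ cong (_+ code n π t) (suc-pred t {{>-nonZero 1≤t}}) ⟨
    suc (pred t) + code n π t                           ≡⟨ cong (λ z → suc z + code n π t) smaller ⟨
    suc (smallerBefore + smallerAfter t) + code n π t   ≡⟨ cong suc (+-swapʳ smallerBefore (smallerAfter t) (code n π t)) ⟩
    suc (smallerBefore + code n π t) + smallerAfter t   ≡⟨ cong (λ z → suc z + smallerAfter t) before ⟩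
    suc (pred (pos t)) + smallerAfter t                 ≡⟨ cong (_+ smallerAfter t) (suc-pred (pos t) {{>-nonZero 1≤pos}}) ⟩
    pos t + smallerAfter t                              ∎
    where
    open ≡-Reasoning
    1≤pos = proj₁ (pos-range t 1≤t t≤n)
    smallerBefore = ∑ (λ v → χ< v t * χ< (pos v) (pos t)) n
    +-swapʳ : ∀ x y z → x + y + z ≡ x + z + y
    +-swapʳ = solve-∀
    split-before : ∀ v → χ< (pos v) (pos t) ≡ χ< v t * χ< (pos v) (pos t) + χ< t v * χ< (pos v) (pos t)
    split-before v with compareχ v t
    ... | χ-less _ e₁ e₂ _    rewrite e₁ | e₂ = sym (trans (+-identityʳ _) (+-identityʳ _))
    ... | χ-equal refl e₁ _ _ rewrite e₁ | χ<-0 {pos v} ≤-refl = refl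
    ... | χ-greater _ e₁ e₂ _ rewrite e₁ | e₂ = sym (+-identityʳ _)
    split-smaller : ∀ v → χ< v t ≡ χ< v t * χ< (pos v) (pos t) + χ< v t * χ< (pos t) (pos v)
    split-smaller v with compareχ v t | compareχ (pos v) (pos t)
    ... | χ-less _ e₁ _ _   | χ-less _ f₁ f₂ _    rewrite e₁ | f₁ | f₂ = refl
    ... | χ-less v<t _ _ _  | χ-equal e _ _ _     = ⊥-elim (<⇒≢ v<t (pos-injective e))
    ... | χ-less _ e₁ _ _   | χ-greater _ f₁ f₂ _ rewrite e₁ | f₁ | f₂ = refl
    ... | χ-equal _ e₁ _ _   | _                rewrite e₁ = refl
    ... | χ-greater _ e₁ _ _ | _                rewrite e₁ = refl
    before : smallerBefore + code n π t ≡ pred (pos t)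
    before = trans (sym (∑-distrib-+ _ _ n))
                   (trans (sym (∑-cong _ _ n (λ v _ _ → split-before v)))
                          (positions-below (pos t) (m≤n⇒m≤1+n (proj₂ (pos-range t 1≤t t≤n)))))
    smaller : smallerBefore + smallerAfter t ≡ pred t
    smaller = trans (sym (∑-distrib-+ _ _ n))
                    (trans (sym (∑-cong _ _ n (λ v _ _ → split-smaller v))) (∑-χ< n t (m≤n⇒m≤1+n t≤n)))

  module Sliding (a : ℕ) (la : Letter n a) (ascent : perm π a < perm π (suc a)) where

    c b : ℕ
    c = perm π a
    b = perm π (suc a)

    pos-c : pos c ≡ a
    pos-c = perm-reverse-cancel π a

    pos-b : pos b ≡ suc a
    pos-b = perm-reverse-cancel π (suc a)

    c-range : 1 ≤ c × c ≤ n
    c-range = perm-range n π a lπ (proj₁ la) (≤-trans (n≤1+n a) (proj₂ la))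

    b-range : 1 ≤ b × b ≤ n
    b-range = perm-range n π (suc a) lπ (s≤s z≤n) (proj₂ la)

    -- The slide of a reaches each tower t ≤ c on the diagonal a + smallerPast t.
    smallerPast : ℕ → ℕ
    smallerPast t = ∑ (λ v → χ< v t * χ< (suc a) (pos v)) n

    smallerPast-1 : smallerPast 1 ≡ 0
    smallerPast-1 = ∑-zero _ n (λ v 1≤v _ → cong (_* χ< (suc a) (pos v)) (χ<-0 1≤v))

    smallerPast-suc : ∀ t → 1 ≤ t → t ≤ n → smallerPast (suc t) ≡ smallerPast t + χ< (suc a) (pos t)
    smallerPast-suc t 1≤t t≤n =
      trans (∑-cong _ _ n (λ v _ _ → split v))
            (trans (∑-distrib-+ _ _ n)
                   (cong (smallerPast t +_)
                         (trans (∑-delta _ n t 1≤t t≤n (λ v _ _ v≢t → cong (_* χ< (suc a) (pos v)) (χ≡-0 v≢t)))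
                                (trans (cong (_* χ< (suc a) (pos t)) (χ≡-refl t)) (+-identityʳ _)))))
      where
      split : ∀ v → χ< v (suc t) * χ< (suc a) (pos v) ≡ χ< v t * χ< (suc a) (pos v) + χ≡ v t * χ< (suc a) (pos v)
      split v with compareχ v t
      ... | χ-less v<t e₁ _ e₃  rewrite e₁ | e₃ | χ<-1 {v} {suc t} (≤-trans v<t (n≤1+n t)) = sym (+-identityʳ _)
      ... | χ-equal refl e₁ _ e₃ rewrite e₁ | e₃ | χ<-1 {v} {suc v} ≤-refl = refl
      ... | χ-greater t<v e₁ _ e₃ rewrite e₁ | e₃ | χ<-0 {v} {suc t} t<v = refl

    private
      pos≢a : ∀ {t} → t < c → pos t ≢ a
      pos≢a t<c e = <⇒≢ t<c (pos-injective (trans e (sym pos-c)))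

      pos≢suc-a : ∀ {t} → t < c → pos t ≢ suc a
      pos≢suc-a t<c e = <⇒≢ (<-trans t<c ascent) (pos-injective (trans e (sym pos-b)))

    pos<a-before-c : ∀ t → t < c → ¬ (suc a < pos t) → pos t < a
    pos<a-before-c t t<c ≯ = ≤∧≢⇒< (≤-pred (≤∧≢⇒< (≮⇒≥ ≯) (pos≢suc-a t<c))) (pos≢a t<c)

    code-at-c : c + code n π c ≡ a + smallerPast c
    code-at-c = trans (code-balance c (proj₁ c-range) (proj₂ c-range))
                      (cong₂ _+_ pos-c (∑-cong _ _ n (λ v _ _ → same v)))
      where
      same : ∀ v → χ< v c * χ< (pos c) (pos v) ≡ χ< v c * χ< (suc a) (pos v)
      same v rewrite pos-c with tauView a (pos v)
      ... | fst e     rewrite pos-injective (trans e (sym pos-c)) | χ<-0 {c} ≤-refl = refl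
      ... | snd e     rewrite pos-injective (trans e (sym pos-b)) | χ<-0 (<⇒≤ ascent) = refl
      ... | fixed p q = cong (χ< v c *_) (χ<-off-pairʳ (pos v) a p q)

    code-below : ∀ t → 1 ≤ t → t < c → pos t < a → suc (t + code n π t) ≤ a + smallerPast t
    code-below t 1≤t t<c pos<a = begin
      suc (t + code n π t)               ≡⟨ cong suc (code-balance t 1≤t t≤n) ⟩
      suc (pos t + smallerAfter t)       ≤⟨ s≤s (+-monoʳ-≤ (pos t) after≤) ⟩
      suc (pos t + (between + smallerPast t))  ≡⟨ rearrange (pos t) between (smallerPast t) ⟩
      (between + suc (pos t)) + smallerPast t  ≡⟨ cong (_+ smallerPast t) (positions-between (pos t) a 1≤pos pos<a a≤n) ⟩
      a + smallerPast t                  ∎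
      where
      open ≤-Reasoning
      t≤n = ≤-trans (<⇒≤ t<c) (proj₂ c-range)
      a≤n = ≤-trans (n≤1+n a) (proj₂ la)
      1≤pos = proj₁ (pos-range t 1≤t t≤n)
      rearrange : ∀ x y z → suc (x + (y + z)) ≡ y + suc x + z
      rearrange = solve-∀
      between = ∑ (λ v → χ< (pos t) (pos v) * χ< (pos v) a) n
      split : ∀ v → χ< v t * χ< (pos t) (pos v) ≤ χ< (pos t) (pos v) * χ< (pos v) a + χ< v t * χ< (suc a) (pos v)
      split v with compareχ (pos v) a
      ... | χ-less _ e _ _ rewrite e | *-identityʳ (χ< (pos t) (pos v)) = ≤-trans (χ<*-≤ v t _) (m≤m+n _ _)
      ... | χ-equal e _ _ _ rewrite pos-injective (trans e (sym pos-c)) | χ<-0 (<⇒≤ t<c) = z≤n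
      ... | χ-greater a<pos _ _ _ with tauView a (pos v)
      ...   | fst e     = ⊥-elim (<⇒≢ a<pos (sym e))
      ...   | snd e     rewrite pos-injective (trans e (sym pos-b)) | χ<-0 (<⇒≤ (<-trans t<c ascent)) = z≤n
      ...   | fixed _ q rewrite χ<-1 (≤∧≢⇒< a<pos (≢-sym q)) | *-identityʳ (χ< v t) =
        ≤-trans (*χ<-≤ (pos t) (pos v) (χ< v t)) (m≤n+m _ _)
      after≤ : smallerAfter t ≤ between + smallerPast t
      after≤ = ≤-trans (∑-mono-≤ _ _ n (λ v _ _ → split v)) (≤-reflexive (∑-distrib-+ _ _ n))

    code-above : ∀ t → 1 ≤ t → t ≤ n → suc a < pos t → suc (suc (a + smallerPast t)) ≤ t + code n π t
    code-above t 1≤t t≤n a<pos = begin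
      suc (suc (a + smallerPast t))        ≤⟨ s≤s (s≤s (+-monoʳ-≤ a past≤)) ⟩
      suc (suc (a + (smallerAfter t + between))) ≡⟨ rearrange a (smallerAfter t) between ⟩
      (between + suc (suc a)) + smallerAfter t   ≡⟨ cong (_+ smallerAfter t) (positions-between (suc a) (pos t) (s≤s z≤n) a<pos pos≤n) ⟩
      pos t + smallerAfter t               ≡⟨ code-balance t 1≤t t≤n ⟨
      t + code n π t                       ∎
      where
      open ≤-Reasoning
      pos≤n = proj₂ (pos-range t 1≤t t≤n)
      rearrange : ∀ x y z → suc (suc (x + (y + z))) ≡ z + suc (suc x) + y
      rearrange = solve-∀
      between = ∑ (λ v → χ< (suc a) (pos v) * χ< (pos v) (pos t)) n
      split : ∀ v → χ< v t * χ< (suc a) (pos v) ≤ χ< v t * χ< (pos t) (pos v) + χ< (suc a) (pos v) * χ< (pos v) (pos t)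
      split v with compareχ (pos v) (pos t)
      ... | χ-less _ e _ _    rewrite e | *-identityʳ (χ< (suc a) (pos v)) = ≤-trans (χ<*-≤ v t _) (m≤n+m _ _)
      ... | χ-equal e _ _ _   rewrite pos-injective e | χ<-0 {t} ≤-refl = z≤n
      ... | χ-greater _ _ e _ rewrite e | *-identityʳ (χ< v t) = ≤-trans (*χ<-≤ (suc a) (pos v) (χ< v t)) (m≤m+n _ _)
      past≤ : smallerPast t ≤ smallerAfter t + between
      past≤ = ≤-trans (∑-mono-≤ _ _ n (λ v _ _ → split v)) (≤-reflexive (∑-distrib-+ _ _ n))

    -- Appending the ascent a swaps the positions a, a + 1 of c < b, creating the one new
    -- inversion (b before c): the code grows at c only.
    code-∷ʳ : ∀ t → code n (π ++ [ a ]) t ≡ code n π t + χ≡ t c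
    code-∷ʳ t rewrite reverse-∷ʳ π a =
      trans (∑-cong _ _ n (λ v _ _ → split v))
            (trans (∑-distrib-+ _ _ n)
                   (cong (code n π t +_)
                         (trans (∑-delta _ n b (proj₁ b-range) (proj₂ b-range)
                                   (λ v _ _ v≢b → trans (cong (χ≡ t c *_) (χ≡-0 v≢b)) (*-zeroʳ (χ≡ t c))))
                                (trans (cong (χ≡ t c *_) (χ≡-refl b)) (*-identityʳ _)))))
      where
      split : ∀ v → χ< t v * χ< (τ a (pos v)) (τ a (pos t)) ≡ χ< t v * χ< (pos v) (pos t) + χ≡ t c * χ≡ v b
      split v with tauView a (pos v) | tauView a (pos t)
      ... | fst e | fst f
        rewrite pos-injective (trans e (sym f)) | χ<-0 {t} ≤-refl | pos-injective (trans f (sym pos-c))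
              | χ≡-0 (<⇒≢ ascent) = sym (*-zeroʳ (χ≡ c c))
      ... | fst e | snd f
        rewrite pos-injective (trans e (sym pos-c)) | pos-injective (trans f (sym pos-b))
              | χ<-0 (<⇒≤ ascent) | χ≡-0 (≢-sym (<⇒≢ ascent)) = refl
      ... | snd e | fst f
        rewrite pos-injective (trans e (sym pos-b)) | pos-injective (trans f (sym pos-c)) | pos-b | pos-c
              | τ-fst a | τ-snd a | χ<-1 ascent | χ≡-refl c | χ≡-refl b | χ<-1 {a} ≤-refl | χ<-0 {suc a} (n≤1+n a) = refl
      ... | snd e | snd f
        rewrite pos-injective (trans e (sym f)) | χ<-0 {t} ≤-refl | pos-injective (trans f (sym pos-b))
              | χ≡-0 (≢-sym (<⇒≢ ascent)) = refl
      ... | fst e | fixed p q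
        rewrite e | τ-fst a | τ-fix a (pos t) p q | χ≡-0 {t} {c} (λ z → p (trans (cong pos z) pos-c))
              | χ<-off-pairʳ (pos t) a p q = sym (+-identityʳ _)
      ... | snd e | fixed p q
        rewrite e | τ-snd a | τ-fix a (pos t) p q | χ≡-0 {t} {c} (λ z → p (trans (cong pos z) pos-c))
              | χ<-off-pairʳ (pos t) a p q = sym (+-identityʳ _)
      ... | fixed p q | fst f
        rewrite f | τ-fst a | τ-fix a (pos v) p q | χ≡-0 {v} {b} (λ z → q (trans (cong pos z) pos-b))
              | χ<-off-pairˡ (pos v) a p q = sym (trans (cong (χ< t v * χ< (pos v) (suc a) +_) (*-zeroʳ (χ≡ t c))) (+-identityʳ _))
      ... | fixed p q | snd f
        rewrite f | τ-snd a | τ-fix a (pos v) p q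
              | χ≡-0 {t} {c} (λ z → <⇒≢ (n<1+n a) (trans (sym pos-c) (trans (cong pos (sym z)) f)))
              | χ<-off-pairˡ (pos v) a p q = sym (+-identityʳ _)
      ... | fixed p q | fixed p′ q′
        rewrite τ-fix a (pos v) p q | τ-fix a (pos t) p′ q′
              | χ≡-0 {t} {c} (λ z → p′ (trans (cong pos z) pos-c)) = sym (+-identityʳ _)

    data NextStop (p : ℕ) : Set where
      stop : ∀ q → p ≤ q → q ≤ c → (q ≡ c ⊎ (q < c × suc a < pos q)) →
             (∀ t → p ≤ t → t < q → ¬ (suc a < pos t)) → NextStop p

    nextStop : ∀ k p → p + k ≡ c → NextStop p
    nextStop zero    p p+0≡c = stop p ≤-refl (≤-reflexive p≡c) (inj₁ p≡c) (λ t p≤t t<p → ⊥-elim (<⇒≱ t<p p≤t))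
      where p≡c = trans (sym (+-identityʳ p)) p+0≡c
    nextStop (suc k) p p+k≡c with suc a <? pos p
    ... | yes high = stop p ≤-refl (<⇒≤ p<c) (inj₂ (p<c , high)) (λ t p≤t t<p → ⊥-elim (<⇒≱ t<p p≤t))
      where p<c = subst (p <_) p+k≡c (m<m+n p (s≤s z≤n))
    ... | no low with nextStop k (suc p) (trans (sym (+-suc p k)) p+k≡c)
    ...   | stop q p<q q≤c end skip = stop q (<⇒≤ p<q) q≤c end skip′
      where
      skip′ : ∀ t → p ≤ t → t < q → ¬ (suc a < pos t)
      skip′ t p≤t t<q with m≤n⇒m<n∨m≡n p≤t
      ... | inj₁ p<t  = skip t p<t t<q
      ... | inj₂ refl = low

    nextStop-from : ∀ p → p ≤ c → NextStop p
    nextStop-from p p≤c = let (k , p+k≡c) = m≤n⇒∃[o]m+o≡n p≤c in nextStop k p p+k≡c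

    smallerPast-flat : ∀ p k → 1 ≤ p → p + k ≤ n → (∀ t → p ≤ t → t < p + k → ¬ (suc a < pos t)) →
      smallerPast (p + k) ≡ smallerPast p
    smallerPast-flat p zero    _   _   _   = cong smallerPast (+-identityʳ p)
    smallerPast-flat p (suc k) 1≤p ≤n low = begin
      smallerPast (p + suc k)                          ≡⟨ cong smallerPast (+-suc p k) ⟩
      smallerPast (suc (p + k))                        ≡⟨ smallerPast-suc (p + k) (≤-trans 1≤p (m≤m+n p k)) (<⇒≤ p+k<) ⟩
      smallerPast (p + k) + χ< (suc a) (pos (p + k))  ≡⟨ cong₂ _+_ (smallerPast-flat p k 1≤p (<⇒≤ p+k<) (λ t p≤t t< → low t p≤t (<-trans t< last)))
                                                                    (χ<-0 (≮⇒≥ (low (p + k) (m≤m+n p k) last))) ⟩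
      smallerPast p + 0                                ≡⟨ +-identityʳ _ ⟩
      smallerPast p                                    ∎
      where
      open ≡-Reasoning
      last : p + k < p + suc k
      last = +-monoʳ-< p (n<1+n k)
      p+k< : p + k < n
      p+k< = <-≤-trans last ≤n

    module _ (D : TowerDiagram) (shape : ∀ t → 1 ≤ t → size D t ≡ code n π t) where

      module _ {p q : ℕ} (1≤p : 1 ≤ p) (p≤q : p ≤ q) (q≤c : q ≤ c)
               (skip : ∀ t → p ≤ t → t < q → ¬ (suc a < pos t)) where

        private
          d = a + smallerPast p

        flat-until-stop : ∀ t → p ≤ t → t ≤ q → smallerPast t ≡ smallerPast p
        flat-until-stop t p≤t t≤q with m≤n⇒∃[o]m+o≡n p≤t
        ... | (k , refl) = smallerPast-flat p k 1≤p (≤-trans t≤q (≤-trans q≤c (proj₂ c-range)))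
                                            (λ u p≤u u<t → skip u p≤u (<-≤-trans u<t t≤q))

        below-until-stop : ∀ t → p ≤ t → t < q → suc (t + size D t) ≤ d
        below-until-stop t p≤t t<q = begin
          suc (t + size D t)     ≡⟨ cong (λ z → suc (t + z)) (shape t 1≤t) ⟩
          suc (t + code n π t)   ≤⟨ code-below t 1≤t t<c (pos<a-before-c t t<c (skip t p≤t t<q)) ⟩
          a + smallerPast t      ≡⟨ cong (a +_) (flat-until-stop t p≤t (<⇒≤ t<q)) ⟩
          d                      ∎
          where
          open ≤-Reasoning
          1≤t = ≤-trans 1≤p p≤t
          t<c = <-≤-trans t<q q≤c

        stop≤diagonal : p ≤ d → q ≤ d
        stop≤diagonal p≤d with q ≤? d
        ... | yes q≤d = q≤d
        ... | no  q≰d = ⊥-elim (<⇒≱ (below-until-stop d p≤d (≰⇒> q≰d)) (m≤m+n d (size D d)))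

        ends-at-stop : q ≡ c → q + size D q ≡ d
        ends-at-stop refl = begin
          q + size D q         ≡⟨ cong (q +_) (shape q (≤-trans 1≤p p≤q)) ⟩
          q + code n π q       ≡⟨ code-at-c ⟩
          a + smallerPast q    ≡⟨ cong (a +_) (flat-until-stop q p≤q ≤-refl) ⟩
          d                    ∎
          where open ≡-Reasoning

        module _ (q<c : q < c) (high : suc a < pos q) where

          private
            1≤q = ≤-trans 1≤p p≤q
            q≤n = ≤-trans (<⇒≤ q<c) (proj₂ c-range)

          rises-at-stop : suc (suc d) ≤ q + size D q
          rises-at-stop = begin
            suc (suc d)                    ≡⟨ cong (λ z → suc (suc (a + z))) (flat-until-stop q p≤q ≤-refl) ⟨
            suc (suc (a + smallerPast q))  ≤⟨ code-above q 1≤q q≤n high ⟩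
            q + code n π q                 ≡⟨ cong (q +_) (shape q 1≤q) ⟨
            q + size D q                   ∎
            where open ≤-Reasoning

          next-diagonal : suc d ≡ a + smallerPast (suc q)
          next-diagonal = begin
            suc (a + smallerPast p)                  ≡⟨ cong (λ z → suc (a + z)) (flat-until-stop q p≤q ≤-refl) ⟨
            suc (a + smallerPast q)                  ≡⟨ +-suc a (smallerPast q) ⟨
            a + suc (smallerPast q)                  ≡⟨ cong (a +_) (+-comm 1 (smallerPast q)) ⟩
            a + (smallerPast q + 1)                  ≡⟨ cong (λ z → a + (smallerPast q + z)) (χ<-1 high) ⟨
            a + (smallerPast q + χ< (suc a) (pos q)) ≡⟨ cong (a +_) (smallerPast-suc q 1≤q q≤n) ⟨
            a + smallerPast (suc q)                  ∎
            where open ≡-Reasoning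

      -- The fuel bound holds since p ≤ 1 + length D throughout: passing tower q needs size D q ≥ 2.
      lands : ∀ f p → 1 ≤ p → p ≤ c → p ≤ a + smallerPast p → suc (length D) < f + p → p ≤ suc (length D) →
              ∃ λ k → slideF f D p (a + smallerPast p) ≡ just (c , k)
      lands zero    p _   _   _   fuel p≤ = ⊥-elim (<⇒≱ fuel p≤)
      lands (suc f) p 1≤p p≤c p≤d fuel _ with nextStop-from p p≤c
      ... | stop q p≤q q≤c (inj₁ refl) skip =
        size D q , slideF-adds D f p q _ 1≤p p≤q (ends-at-stop 1≤p p≤q q≤c skip refl) (below-until-stop 1≤p p≤q q≤c skip)
      ... | stop q p≤q q≤c (inj₂ (q<c , high)) skip =
        let q≤d   = stop≤diagonal 1≤p p≤q q≤c skip p≤d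
            rises = rises-at-stop 1≤p p≤q q≤c skip q<c high
            next  = next-diagonal 1≤p p≤q q≤c skip q<c high
            1≤size = +-cancelˡ-≤ q 1 (size D q) (≤-trans (≤-reflexive (+-comm q 1)) (≤-trans (s≤s (≤-trans q≤d (n≤1+n _))) rises))
            (k , landed) = lands f (suc q) (s≤s z≤n) q<c (subst (suc q ≤_) next (s≤s q≤d))
                                 (≤-trans fuel (≤-trans (≤-reflexive (sym (+-suc f p))) (+-monoʳ-≤ f (s≤s p≤q))))
                                 (s≤s (size-pos⇒≤length D q 1≤size))
        in k , trans (slideF-passes D f p q _ 1≤p p≤q q≤d rises (below-until-stop 1≤p p≤q q≤c skip))
                     (subst (λ d′ → slideF f D (suc q) d′ ≡ just (c , k)) (sym next) landed)

      slide-lands : ∃ λ k → slide D a ≡ just (c , k)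
      slide-lands =
        subst (λ d → ∃ λ k → slideF (suc (length D)) D 1 d ≡ just (c , k)) (trans (cong (a +_) smallerPast-1) (+-identityʳ a))
              (lands (suc (length D)) 1 ≤-refl (proj₁ c-range) (≤-trans (proj₁ la) (m≤m+n a _))
                     (m<m+n (suc (length D)) (s≤s z≤n)) (s≤s z≤n))

-- The tower tableau of a word of ascents

columns : List ℕ → List ℕ → List ℕ
columns π []      = []
columns π (a ∷ σ) = perm π a ∷ columns (π ++ [ a ]) σ

size-incr : ∀ D i t → 1 ≤ i → 1 ≤ t → size (incr D i) t ≡ size D t + χ≡ t i
size-incr []       (suc zero)    (suc zero)    _ _ = refl
size-incr []       (suc zero)    (suc (suc t)) _ _ = refl
size-incr (k ∷ ks) (suc zero)    (suc zero)    _ _ = +-comm 1 k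
size-incr (k ∷ ks) (suc zero)    (suc (suc t)) _ _ = sym (+-identityʳ _)
size-incr []       (suc (suc i)) (suc zero)    _ _ = refl
size-incr []       (suc (suc i)) (suc (suc t)) _ _ = size-incr [] (suc i) (suc t) (s≤s z≤n) (s≤s z≤n)
size-incr (k ∷ ks) (suc (suc i)) (suc zero)    _ _ = sym (+-identityʳ _)
size-incr (k ∷ ks) (suc (suc i)) (suc (suc t)) _ _ = size-incr ks (suc i) (suc t) (s≤s z≤n) (s≤s z≤n)

buildTableau-∷ : ∀ D acc a σ {cell} → slide D a ≡ just cell →
  buildTableau D acc (a ∷ σ) ≡ buildTableau (incr D (proj₁ cell)) (acc ++ [ cell ]) σ
buildTableau-∷ D acc a σ slid rewrite slid = refl

buildTableau-columns : ∀ n π σ D (acc : List Cell) → All (Letter n) π → All (Letter n) σ → Ascents π σ →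
  (∀ t → 1 ≤ t → size D t ≡ code n π t) →
  ∃ λ T → buildTableau D acc σ ≡ just T × map proj₁ T ≡ map proj₁ acc ++ columns π σ
buildTableau-columns n π []      D acc _  _          _               _     =
  acc , refl , sym (++-identityʳ (map proj₁ acc))
buildTableau-columns n π (a ∷ σ) D acc lπ (la ∷ lσ) (ascent , asc) shape =
  let (k , slid)         = slide-lands D shape
      (T , built , cols) = buildTableau-columns n (π ++ [ a ]) σ (incr D c) (acc ++ [ (c , k) ])
                             (All-++⁺ lπ (la ∷ [])) lσ asc shape′
  in T , trans (buildTableau-∷ D acc a σ slid) built ,
     trans cols (trans (cong (_++ columns (π ++ [ a ]) σ) (map-++ proj₁ acc [ (c , k) ]))
                       (++-assoc (map proj₁ acc) [ c ] (columns (π ++ [ a ]) σ)))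
  where
  open Positions n π lπ
  open Sliding a la ascent
  shape′ : ∀ t → 1 ≤ t → size (incr D c) t ≡ code n (π ++ [ a ]) t
  shape′ t 1≤t = trans (size-incr D c t (proj₁ c-range) 1≤t) (trans (cong (_+ χ≡ t c) (shape t 1≤t)) (sym (code-∷ʳ t)))

towerTableau-columns : ∀ n α → All (Letter n) α → Ascents [] α →
  ∃ λ T → towerTableau α ≡ just T × map proj₁ T ≡ columns [] α
towerTableau-columns n α lα asc = buildTableau-columns n [] α [] [] [] lα asc empty
  where
  empty : ∀ t → 1 ≤ t → size [] t ≡ code n [] t
  empty t _ = sym (∑-zero _ n (λ v _ _ → no-inversion t v))
    where
    no-inversion : ∀ t v → χ< t v * χ< v t ≡ 0
    no-inversion t v with compareχ t v
    ... | χ-less _ _ e _      rewrite e = *-zeroʳ (χ< t v)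
    ... | χ-equal refl e _ _  rewrite e = refl
    ... | χ-greater _ e _ _   rewrite e = refl

columns-∷ʳ : ∀ π σ a → columns π (σ ++ [ a ]) ≡ columns π σ ++ [ perm (π ++ σ) a ]
columns-∷ʳ π []      a = cong (λ z → perm z a ∷ []) (sym (++-identityʳ π))
columns-∷ʳ π (x ∷ σ) a = cong (perm π x ∷_)
  (trans (columns-∷ʳ (π ++ [ x ]) σ a) (cong (λ z → columns (π ++ [ x ]) σ ++ [ perm z a ]) (++-assoc π [ x ] σ)))

columns-indexed : ∀ π σ → columns π σ ≡ applyUpTo (λ i → perm (π ++ take i σ) (at σ (suc i))) (length σ)
columns-indexed π []      = refl
columns-indexed π (a ∷ σ) = cong₂ _∷_ (cong (λ z → perm z a) (sym (++-identityʳ π)))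
  (trans (columns-indexed (π ++ [ a ]) σ)
         (applyUpTo-cong (λ i → cong (λ z → perm z (at σ (suc i))) (++-assoc π [ a ] (take i σ))) (length σ)))

reverse-columns-reverse : ∀ π σ →
  reverse (columns π (reverse σ)) ≡ applyUpTo (λ i → perm (π ++ reverse (drop (suc i) σ)) (at σ (suc i))) (length σ)
reverse-columns-reverse π []      = refl
reverse-columns-reverse π (a ∷ σ) = begin
  reverse (columns π (reverse (a ∷ σ)))                       ≡⟨ cong (λ z → reverse (columns π z)) (unfold-reverse a σ) ⟩
  reverse (columns π (reverse σ ++ [ a ]))                    ≡⟨ cong reverse (columns-∷ʳ π (reverse σ) a) ⟩
  reverse (columns π (reverse σ) ++ [ perm (π ++ reverse σ) a ]) ≡⟨ reverse-++ (columns π (reverse σ)) [ perm (π ++ reverse σ) a ] ⟩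
  perm (π ++ reverse σ) a ∷ reverse (columns π (reverse σ))   ≡⟨ cong (perm (π ++ reverse σ) a ∷_) (reverse-columns-reverse π σ) ⟩
  perm (π ++ reverse σ) a ∷ applyUpTo (λ i → perm (π ++ reverse (drop (suc i) σ)) (at σ (suc i))) (length σ) ∎
  where open ≡-Reasoning

-- The Rothe diagram and the Rothification

∈-idPerm⁻ : ∀ {n v} → v ∈ idPerm n → 1 ≤ v × v ≤ n
∈-idPerm⁻ v∈ with ∈-applyUpTo⁻ suc v∈
... | (i , i<n , refl) = s≤s z≤n , i<n

∈-idPerm⁺ : ∀ {n v} → 1 ≤ v → v ≤ n → v ∈ idPerm n
∈-idPerm⁺ {v = suc v} _ v≤n = ∈-applyUpTo⁺ suc v≤n

rothe-∈⁺ : ∀ n ω i j → 1 ≤ i → i < j → j ≤ n → at ω j < at ω i → (i , at ω j) ∈ rothe n ω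
rothe-∈⁺ n ω i j 1≤i i<j j≤n inverted =
  ∈-map⁺ (λ p → (proj₁ p , at ω (proj₂ p)))
    (∈-filter⁺ (λ p → T? (at ω (proj₂ p) <ᵇ at ω (proj₁ p)))
      (∈-filter⁺ (λ p → T? (proj₁ p <ᵇ proj₂ p))
        (∈-cartesianProduct⁺ (∈-idPerm⁺ 1≤i (≤-trans (<⇒≤ i<j) j≤n)) (∈-idPerm⁺ (≤-trans 1≤i (<⇒≤ i<j)) j≤n))
        (<⇒<ᵇ i<j))
      (<⇒<ᵇ inverted))

rothe-∈⁻ : ∀ n ω x y → (x , y) ∈ rothe n ω →
  ∃ λ j → 1 ≤ x × x < j × j ≤ n × at ω j < at ω x × y ≡ at ω j
rothe-∈⁻ n ω x y x,y∈ with ∈-map⁻ (λ p → (proj₁ p , at ω (proj₂ p))) x,y∈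
... | ((i , j) , p∈ , refl) with ∈-filter⁻ (λ p → T? (at ω (proj₂ p) <ᵇ at ω (proj₁ p))) p∈
...   | (p∈′ , inverted) with ∈-filter⁻ (λ p → T? (proj₁ p <ᵇ proj₂ p)) p∈′
...     | (p∈″ , i<j) with ∈-cartesianProduct⁻ (idPerm n) (idPerm n) p∈″
...       | (i∈ , j∈) = j , proj₁ (∈-idPerm⁻ i∈) , <ᵇ⇒< i j i<j , proj₂ (∈-idPerm⁻ j∈) , <ᵇ⇒< _ _ inverted , refl

-- Step i + 1 of α swaps two values: column α i is the smaller one and row α i the position
-- in ω of the larger one.
column row : List ℕ → ℕ → ℕ
column α i = perm (take i α) (at α (suc i))
row    α i = perm (reverse (drop (suc i) α)) (at α (suc i))

rotheLabelling : List ℕ → List (Cell × ℕ)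
rotheLabelling α = applyUpTo (λ i → ((row α i , column α i) , suc i)) (length α)

zipWith-rothification : ∀ (col rw lab : ℕ → ℕ) k (T T′ : List Cell) →
  map proj₁ T ≡ applyUpTo col k → map proj₁ T′ ≡ applyUpTo rw k →
  zipWith (λ uv r → ((proj₁ (proj₂ uv) , proj₁ (proj₁ uv)) , r)) (zipWith _,_ T T′) (applyUpTo lab k)
    ≡ applyUpTo (λ i → ((rw i , col i) , lab i)) k
zipWith-rothification col rw lab zero    []      _         _ _ = refl
zipWith-rothification col rw lab (suc k) (u ∷ T) (v ∷ T′) cols rows
  with ∷-injective cols | ∷-injective rows
... | (refl , cols′) | (refl , rows′) =
  cong (_ ∷_) (zipWith-rothification (col ∘ suc) (rw ∘ suc) (lab ∘ suc) k T T′ cols′ rows′)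

rothification-towerTableau : ∀ n α → All (Letter n) α → Ascents [] α →
  ∃ λ T → towerTableau α ≡ just T × rothification α T ≡ just (rotheLabelling α)
rothification-towerTableau n α lα asc
  with towerTableau-columns n α lα asc
     | towerTableau-columns n (reverse α) (All-reverse α lα) (ascents-reverse α asc)
... | (T , tableau , cols) | (T′ , tableau′ , cols′) = T , tableau , roth
  where
  cols-T : map proj₁ T ≡ applyUpTo (column α) (length α)
  cols-T = trans cols (columns-indexed [] α)
  rows-T′ : map proj₁ (reverse T′) ≡ applyUpTo (row α) (length α)
  rows-T′ = trans (reverse-map proj₁ T′) (trans (cong reverse cols′) (reverse-columns-reverse [] α))
  length-T : length T ≡ length α
  length-T = trans (sym (length-map proj₁ T)) (trans (cong length cols-T) (length-applyUpTo (column α) (length α)))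
  roth : rothification α T ≡ just (rotheLabelling α)
  roth rewrite tableau′ | length-T =
    cong just (zipWith-rothification (column α) (row α) suc (length α) T (reverse T′) cols-T rows-T′)

take++at∷drop : ∀ (α : List ℕ) i → i < length α → take i α ++ at α (suc i) ∷ drop (suc i) α ≡ α
take++at∷drop (x ∷ xs) zero    _         = refl
take++at∷drop (x ∷ xs) (suc i) (s≤s i<l) = cong (x ∷_) (take++at∷drop xs i i<l)

module Step (n : ℕ) (ω α : List ℕ) (red : IsReducedWord n ω α) (i : ℕ) (i<l : i < length α) where

  γ δ : List ℕ
  γ = take i α
  δ = drop (suc i) α

  a c b : ℕ
  a = at α (suc i)
  c = perm γ a
  b = perm γ (suc a)

  private
    lα = proj₁ red
    split = sym (take++at∷drop α i i<l)
    lγa = subst (All (Letter n)) split lα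
    lγ = All-++⁻ˡ γ lγa
    la : Letter n a
    la with All-++⁻ʳ γ lγa
    ... | la ∷ _ = la
    asc = subst (Ascents []) split (reduced⇒ascents n ω α red)

  c<b : c < b
  c<b = proj₁ (ascents-split [] γ a δ asc)

  c-range : 1 ≤ c × c ≤ n
  c-range = perm-range n γ a lγ (proj₁ la) (≤-trans (n≤1+n a) (proj₂ la))

  b-range : 1 ≤ b × b ≤ n
  b-range = perm-range n γ (suc a) lγ (s≤s z≤n) (proj₂ la)

  ω-at : ∀ k → 1 ≤ k → k ≤ n → at ω k ≡ perm α k
  ω-at k 1≤k k≤n = trans (cong (λ w → at w k) (sym (proj₁ (proj₂ red)))) (wordPerm-at n α k lα 1≤k k≤n)

  position-of : ∀ k → perm (reverse α) (perm γ k) ≡ perm (reverse δ) (τ a k)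
  position-of k = trans (cong (λ z → perm (reverse z) (perm γ k)) split) (perm-reverse-split γ a δ k)

  position-b : perm (reverse α) b ≡ row α i
  position-b = trans (position-of (suc a)) (cong (perm (reverse δ)) (τ-snd a))

  row<position-c : row α i < perm (reverse α) c
  row<position-c = subst (row α i <_) (sym (trans (position-of a) (cong (perm (reverse δ)) (τ-fst a))))
                         (ascent-of-suffix-inverse γ a δ asc)

  row-range : 1 ≤ row α i × row α i ≤ n
  row-range = subst (λ z → 1 ≤ z × z ≤ n) position-b
                    (perm-range n (reverse α) b (All-reverse α lα) (proj₁ b-range) (proj₂ b-range))

  position-c-range : 1 ≤ perm (reverse α) c × perm (reverse α) c ≤ n
  position-c-range = perm-range n (reverse α) c (All-reverse α lα) (proj₁ c-range) (proj₂ c-range)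

  ω-at-row : at ω (row α i) ≡ b
  ω-at-row = trans (ω-at (row α i) (proj₁ row-range) (proj₂ row-range))
                   (trans (cong (perm α) (sym position-b)) (perm-cancel-reverse α b))

  ω-at-position-c : at ω (perm (reverse α) c) ≡ c
  ω-at-position-c = trans (ω-at _ (proj₁ position-c-range) (proj₂ position-c-range)) (perm-cancel-reverse α c)

  swapped : swappedValues n α (suc i) ≡ (c , b)
  swapped = cong₂ _,_ (wordPerm-at n γ a lγ (proj₁ la) (≤-trans (n≤1+n a) (proj₂ la)))
                      (wordPerm-at n γ (suc a) lγ (s≤s z≤n) (proj₂ la))

rotheLabelling-sound : ∀ n ω α → IsReducedWord n ω α →
  ∀ x y r → ((x , y) , r) ∈ rotheLabelling α → CanonLabel n ω α (x , y) r
rotheLabelling-sound n ω α red x y r x,y,r∈ with ∈-applyUpTo⁻ _ x,y,r∈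
... | (i , i<l , refl) = in-rothe , s≤s z≤n , i<l , inj₂ (cong proj₁ swapped , trans (cong proj₂ swapped) (sym ω-at-row))
  where
  open Step n ω α red i i<l
  in-rothe : (row α i , column α i) ∈ rothe n ω
  in-rothe = subst (λ z → (row α i , z) ∈ rothe n ω) ω-at-position-c
    (rothe-∈⁺ n ω (row α i) (perm (reverse α) c) (proj₁ row-range) row<position-c (proj₂ position-c-range)
              (subst₂ _<_ (sym ω-at-position-c) (sym ω-at-row) c<b))

rotheLabelling-complete : ∀ n ω α → IsReducedWord n ω α →
  ∀ x y r → CanonLabel n ω α (x , y) r → ((x , y) , r) ∈ rotheLabelling α
rotheLabelling-complete n ω α red x y zero    (_ , () , _)
rotheLabelling-complete n ω α red x y (suc i) (x,y∈ , _ , i<l , swaps) with rothe-∈⁻ n ω x y x,y∈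
... | (j , 1≤x , x<j , j≤n , inverted , y≡) =
  [ orientation , found ]′
    (subst (λ p → (proj₁ p ≡ at ω x × proj₂ p ≡ y) ⊎ (proj₁ p ≡ y × proj₂ p ≡ at ω x)) swapped swaps)
  where
  open Step n ω α red i i<l
  orientation : c ≡ at ω x × b ≡ y → ((x , y) , suc i) ∈ rotheLabelling α
  orientation (c≡ , b≡) = ⊥-elim (<-asym c<b (subst₂ _<_ (sym (trans b≡ y≡)) (sym c≡) inverted))
  found : c ≡ y × b ≡ at ω x → ((x , y) , suc i) ∈ rotheLabelling α
  found (c≡y , b≡) = subst (_∈ rotheLabelling α) (cong₂ (λ u v → ((u , v) , suc i)) row≡x c≡y) (∈-applyUpTo⁺ _ i<l)
    where
    row≡x : row α i ≡ x
    row≡x = trans (sym position-b)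
                  (trans (cong (perm (reverse α)) (trans b≡ (ω-at x 1≤x (≤-trans (<⇒≤ x<j) j≤n)))) (perm-reverse-cancel α x))

mainTheorem5 : (n : ℕ) (ω α : List ℕ) → IsReducedWord n ω α →
    ∃ λ T → towerTableau α ≡ just T × ∃ λ R → rothification α T ≡ just R ×
      (∀ (c : Cell) (r : ℕ) → ((c , r) ∈ R) ⇔ CanonLabel n ω α c r)
mainTheorem5 n ω α red =
  let (T , tableau , roth) = rothification-towerTableau n α (proj₁ red) (reduced⇒ascents n ω α red)
  in T , tableau , rotheLabelling α , roth ,
     λ { (x , y) r → mk⇔ (rotheLabelling-sound n ω α red x y r) (rotheLabelling-complete n ω α red x y r) }
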